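{- Let $\mathcal{P}\subset\mathbb{R}^n$ be a rational polytope with $0\in\mathcal{P}$. Then $\mathcal{P}^\vee$ is a lattice polyhedron if and only if $\operatorname{llenv}\operatorname{cone}\mathcal{P}=(\operatorname{lenv}\operatorname{cone}\mathcal{P})\cap\mathbb{Z}^{n+1}$.
   Context: A rational polytope has all vertices in $\mathbb{Q}^n$. $\mathcal{P}^\vee=\{\phi\in(\operatorname{lin}\mathcal{P})^*:\phi(a)\le1\ \forall a\in\mathcal{P}\}$ (polar dual relative to the linear span $\operatorname{lin}\mathcal{P}$); it is a lattice polyhedron if its vertices lie in $\{\phi\in(\operatorname{lin}\mathcal{P})^*:\phi(a)\in\mathbb{Z}\ \forall a\in\operatorname{lin}\mathcal{P}\cap\mathbb{Z}^n\}$. $\operatorname{cone}\mathcal{P}\subset\mathbb{R}^{n+1}$ is the set of nonnegative multiples of points $(a,1)$, $a\in\mathcal{P}$. For a closed linear cone $\mathcal{C}$ not containing $-e_{n+1}$, $\epsilon_{\mathcal{C}}(x)=x-\max\{\lambda:x-\lambda e_{n+1}\in\mathcal{C}\}e_{n+1}$, $\operatorname{lenv}\mathcal{C}=\epsilon_{\mathcal{C}}(\mathcal{C})$, $\operatorname{llenv}\mathcal{C}=\epsilon_{\mathcal{C}}(\mathcal{C}\cap\mathbb{Z}^{n+1})$.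
   Formalization: Stated over ℚ instead of ℝ: the points of $\mathcal{P}$, $\operatorname{cone}\mathcal{P}$ and $\operatorname{lin}\mathcal{P}$, the functionals in $\mathcal{P}^\vee$, and the shifts λ defining $\epsilon_{\mathcal{C}}$ are rational. -}

module Defs where

open import Data.Nat using (ℕ; suc)
open import Data.Fin using (Fin; zero; suc)
open import Data.Integer using (ℤ)
open import Data.Rational using (ℚ; 0ℚ; 1ℚ; _+_; _*_; _-_; _≤_; _<_; _/_)
open import Data.Product using (Σ; ∃; ∃-syntax; _×_; _,_)
open import Relation.Binary.PropositionalEquality using (_≡_)

Pt : ℕ → Set
Pt n = Fin n → ℚ

-- Points of ℚ^{n+1} = ℚ^n × ℚ ; the second component is the (n+1)-st coordinate.
Pt⁺ : ℕ → Set
Pt⁺ n = Pt n × ℚ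

∑ : ∀ {k} → (Fin k → ℚ) → ℚ
∑ {ℕ.zero} f = 0ℚ
∑ {suc k} f = f zero + ∑ (λ j → f (suc j))

zeroPt : ∀ {n} → Pt n
zeroPt _ = 0ℚ

_≋_ : ∀ {n} → Pt n → Pt n → Set
x ≋ y = ∀ i → x i ≡ y i

_•_ : ∀ {n} → ℚ → Pt n → Pt n
(t • x) i = t * x i

⟪_,_⟫ : ∀ {n} → Pt n → Pt n → ℚ
⟪ φ , a ⟫ = ∑ (λ i → φ i * a i)

IsInt : ℚ → Set
IsInt q = ∃[ z ] q ≡ (z / 1)

IsIntPt : ∀ {n} → Pt n → Set
IsIntPt x = ∀ i → IsInt (x i)

IsIntPt⁺ : ∀ {n} → Pt⁺ n → Set
IsIntPt⁺ (x , h) = IsIntPt x × IsInt h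

-- The rational polytope P = conv {V 0, …, V (m-1)} (its rational points).

InP : ∀ {n m} → (Fin m → Pt n) → Pt n → Set
InP {n} {m} V a =
  Σ (Fin m → ℚ) λ w → (∀ j → 0ℚ ≤ w j) × (∑ w ≡ 1ℚ)
    × (a ≋ (λ i → ∑ (λ j → w j * V j i)))

Span : ∀ {n} → (Pt n → Set) → Pt n → Set
Span {n} S x =
  Σ ℕ λ k → Σ (Fin k → Pt n) λ p → Σ (Fin k → ℚ) λ c →
    (∀ j → S (p j)) × (x ≋ (λ i → ∑ (λ j → c j * p j i)))

LinP : ∀ {n m} → (Fin m → Pt n) → Pt n → Set
LinP V = Span (InP V)

-- The dual (lin P)^*: a functional on lin P is represented by a covector
-- φ ∈ ℚ^n, two covectors representing the same functional iff they agree
-- on lin P.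

SameOnLin : ∀ {n m} → (Fin m → Pt n) → Pt n → Pt n → Set
SameOnLin V φ ψ = ∀ a → LinP V a → ⟪ φ , a ⟫ ≡ ⟪ ψ , a ⟫

InDual : ∀ {n m} → (Fin m → Pt n) → Pt n → Set
InDual V φ = ∀ a → InP V a → ⟪ φ , a ⟫ ≤ 1ℚ

IsVertexDual : ∀ {n m} → (Fin m → Pt n) → Pt n → Set
IsVertexDual {n} V φ =
  InDual V φ ×
  (∀ (ψ₁ ψ₂ : Pt n) (t : ℚ) → InDual V ψ₁ → InDual V ψ₂ → 0ℚ < t → t < 1ℚ →
     SameOnLin V φ (λ i → t * ψ₁ i + (1ℚ - t) * ψ₂ i) →
     SameOnLin V ψ₁ ψ₂)

InDualLattice : ∀ {n m} → (Fin m → Pt n) → Pt n → Set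
InDualLattice V φ = ∀ a → LinP V a → IsIntPt a → IsInt ⟪ φ , a ⟫

IsLatticePolyhedronDual : ∀ {n m} → (Fin m → Pt n) → Set
IsLatticePolyhedronDual {n} V = ∀ (φ : Pt n) → IsVertexDual V φ → InDualLattice V φ

InCone : ∀ {n m} → (Fin m → Pt n) → Pt⁺ n → Set
InCone {n} V (x , h) =
  Σ ℚ λ t → Σ (Pt n) λ a → (0ℚ ≤ t) × InP V a × (x ≋ (t • a)) × (h ≡ t)

shift : ∀ {n} → Pt⁺ n → ℚ → Pt⁺ n
shift (x , h) λ' = (x , h - λ')

IsEps : ∀ {n} → (Pt⁺ n → Set) → Pt⁺ n → Pt⁺ n → Set
IsEps C p (y , k) =
  Σ ℚ λ λ' → C (shift p λ') × (∀ μ → C (shift p μ) → μ ≤ λ')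
     × (y ≋ Data.Product.proj₁ (shift p λ')) × (k ≡ Data.Product.proj₂ (shift p λ'))

InLenv : ∀ {n} → (Pt⁺ n → Set) → Pt⁺ n → Set
InLenv {n} C q = Σ (Pt⁺ n) λ p → C p × IsEps C p q

InLlenv : ∀ {n} → (Pt⁺ n → Set) → Pt⁺ n → Set
InLlenv {n} C q = Σ (Pt⁺ n) λ p → C p × IsIntPt⁺ p × IsEps C p q

-- ε_C maps a point of C = cone P to the lowest point of C above it, so both sides of the
-- equivalence say the same thing about heights: for every integral x, the lowest height k
-- with (x , k) ∈ C is an integer.  Writing (x , k) = ∑ μ_j (V_j , 1), that height is the
-- minimum of ∑ μ_j, and by linear programming duality (Farkas' lemma) it equals ⟪ φ , x ⟫
-- for a vertex φ of P^∨ that is tight (⟪ φ , V_j ⟫ = 1) wherever μ_j > 0; so integral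
-- vertices give integral heights.  Conversely the tight vertices of a vertex φ of P^∨ span
-- lin P, and an integral a ∈ lin P is a difference x − N y of integral points of the cone
-- over the tight face, on which φ is the height; hence ⟪ φ , a ⟫ is an integer.

module Submission where

open import Defs
open import Data.Nat as ℕ using (ℕ; zero; suc)
import Data.Nat.Properties as ℕ
open import Data.Nat.Induction using (<-wellFounded)
open import Data.Nat.Coprimality using (1-coprimeTo)
import Data.Nat.Coprimality as Coprime
open import Data.Integer as ℤ using (ℤ)
import Data.Integer.Properties as ℤ
open import Data.Fin using (Fin; zero; suc; _↑ˡ_; _↑ʳ_)
open import Data.Fin.Properties using (all?; ¬∀⟶∃¬)
open import Data.Bool using (Bool; true; false; if_then_else_)
import Data.Bool.Properties as Bool
open import Data.Rational
open import Data.Rational.Properties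
import Data.Rational.Unnormalised as ℚᵘ
open import Data.Vec.Functional using (_∷_; _++_)
open import Data.Vec.Functional.Properties using (lookup-++ˡ; lookup-++ʳ)
open import Data.Product using (Σ; ∃; _×_; _,_; proj₁; proj₂)
open import Data.Sum using (_⊎_; inj₁; inj₂)
import Data.Sum as Sum
open import Data.Empty using (⊥; ⊥-elim)
open import Induction.WellFounded using (Acc; acc)
open import Relation.Nullary
open import Relation.Nullary.Decidable using (toWitness)
import Relation.Nullary.Decidable.Core as Dec
open import Relation.Binary.PropositionalEquality
open import Relation.Binary.Definitions using (tri<; tri≈; tri>)
open import Function.Bundles using (_⇔_; mk⇔; Equivalence)
open import Level using (0ℓ)
open import Tactic.RingSolver using (solve-∀)
open import Tactic.RingSolver.Core.AlmostCommutativeRing using (AlmostCommutativeRing; fromCommutativeRing)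

ringQ : AlmostCommutativeRing 0ℓ 0ℓ
ringQ = fromCommutativeRing +-*-commutativeRing (λ x → Dec.dec⇒maybe (0ℚ ≟ x))

0≤q-p⇒p≤q : ∀ {p q} → 0ℚ ≤ q - p → p ≤ q
0≤q-p⇒p≤q {p} {q} h = subst₂ _≤_ (+-identityʳ p) (p+[q-p]≡q p q) (+-monoʳ-≤ p h)
  where
  p+[q-p]≡q : ∀ p q → p + (q - p) ≡ q
  p+[q-p]≡q = solve-∀ ringQ

p≤q⇒0≤q-p : ∀ {p q} → p ≤ q → 0ℚ ≤ q - p
p≤q⇒0≤q-p {p} {q} h = subst (_≤ q - p) (+-inverseʳ p) (+-monoˡ-≤ (- p) h)

0<q-p⇒p<q : ∀ {p q} → 0ℚ < q - p → p < q
0<q-p⇒p<q {p} {q} h = subst₂ _<_ (+-identityʳ p) (p+[q-p]≡q p q) (+-monoʳ-< p h)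
  where
  p+[q-p]≡q : ∀ p q → p + (q - p) ≡ q
  p+[q-p]≡q = solve-∀ ringQ

p<q⇒0<q-p : ∀ {p q} → p < q → 0ℚ < q - p
p<q⇒0<q-p {p} {q} h = subst (_< q - p) (+-inverseʳ p) (+-monoˡ-< (- p) h)

*-nonNeg : ∀ {p q} → 0ℚ ≤ p → 0ℚ ≤ q → 0ℚ ≤ p * q
*-nonNeg {p} {q} hp hq = nonNegative⁻¹ _ {{nonNeg*nonNeg⇒nonNeg p {{nonNegative hp}} q {{nonNegative hq}}}}

*-pos : ∀ {p q} → 0ℚ < p → 0ℚ < q → 0ℚ < p * q
*-pos {p} {q} hp hq = positive⁻¹ _ {{pos*pos⇒pos p {{positive hp}} q {{positive hq}}}}

*-monoˡ-≤-0≤ : ∀ {r p q} → 0ℚ ≤ r → p ≤ q → r * p ≤ r * q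
*-monoˡ-≤-0≤ {r} h = *-monoˡ-≤-nonNeg r {{nonNegative h}}

*-cancelˡ-≤-0< : ∀ {r p q} → 0ℚ < r → r * p ≤ r * q → p ≤ q
*-cancelˡ-≤-0< {r} h = *-cancelˡ-≤-pos r {{positive h}}

0≤1 : 0ℚ ≤ 1ℚ
0≤1 = *≤* (ℤ.+≤+ ℕ.z≤n)

0<1 : 0ℚ < 1ℚ
0<1 = *<* (ℤ.+<+ (ℕ.s≤s ℕ.z≤n))

≤∧≢⇒< : ∀ {p q} → p ≤ q → p ≢ q → p < q
≤∧≢⇒< {p} {q} p≤q p≢q with <-cmp p q
... | tri< p<q _ _ = p<q
... | tri≈ _ p≡q _ = ⊥-elim (p≢q p≡q)
... | tri> _ _ p>q = ⊥-elim (<-irrefl refl (<-≤-trans p>q p≤q))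

0<p⇒p≢0 : ∀ {p} → 0ℚ < p → p ≢ 0ℚ
0<p⇒p≢0 h p≡0 = <-irrefl (sym p≡0) h

-- The reciprocal made total with the junk value recip 0ℚ = 0ℚ.
recip : ℚ → ℚ
recip q with q ≟ 0ℚ
... | yes _ = 0ℚ
... | no q≢0 = 1/_ q {{≢-nonZero q≢0}}

*-recipʳ : ∀ q → q ≢ 0ℚ → q * recip q ≡ 1ℚ
*-recipʳ q q≢0 with q ≟ 0ℚ
... | yes q≡0 = ⊥-elim (q≢0 q≡0)
... | no q≢0′ = *-inverseʳ q {{≢-nonZero q≢0′}}

recip-pos : ∀ {q} → 0ℚ < q → 0ℚ < recip q
recip-pos {q} h with q ≟ 0ℚ
... | yes q≡0 = ⊥-elim (0<p⇒p≢0 h q≡0)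
... | no _ = positive⁻¹ _ {{1/pos⇒pos q {{positive h}}}}

*-recip-cancelˡ : ∀ p q → p ≢ 0ℚ → p * (q * recip p) ≡ q
*-recip-cancelˡ p q p≢0 = trans (rearrange p q (recip p)) (trans (cong (q *_) (*-recipʳ p p≢0)) (*-identityʳ q))
  where
  rearrange : ∀ p q r → p * (q * r) ≡ q * (p * r)
  rearrange = solve-∀ ringQ

*-cancel-≡0 : ∀ p {q} → p ≢ 0ℚ → p * q ≡ 0ℚ → q ≡ 0ℚ
*-cancel-≡0 p {q} p≢0 pq≡0 = begin
  q                 ≡⟨ sym (*-recip-cancelˡ p q p≢0) ⟩
  p * (q * recip p) ≡⟨ sym (*-assoc p q (recip p)) ⟩
  p * q * recip p   ≡⟨ cong (_* recip p) pq≡0 ⟩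
  0ℚ * recip p      ≡⟨ *-zeroˡ (recip p) ⟩
  0ℚ                ∎
  where open ≡-Reasoning

neg-involutive : ∀ p → - (- p) ≡ p
neg-involutive = solve-∀ ringQ

+-cancelˡ-≡ : ∀ a {x y} → a + x ≡ a + y → x ≡ y
+-cancelˡ-≡ a {x} {y} eq = trans (sym (unshift a x)) (trans (cong (_- a) eq) (unshift a y))
  where
  unshift : ∀ a x → a + x - a ≡ x
  unshift = solve-∀ ringQ

p≤∣p∣ : ∀ p → p ≤ ∣ p ∣
p≤∣p∣ p with ∣p∣≡p∨∣p∣≡-p p
... | inj₁ ∣p∣≡p = ≤-reflexive (sym ∣p∣≡p)
... | inj₂ ∣p∣≡-p = ≤-trans p≤0 (0≤∣p∣ p)
  where
  p≤0 : p ≤ 0ℚ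
  p≤0 = subst (_≤ 0ℚ) (neg-involutive p) (neg-antimono-≤ (subst (0ℚ ≤_) ∣p∣≡-p (0≤∣p∣ p)))

0<1+∣p∣ : ∀ p → 0ℚ < 1ℚ + ∣ p ∣
0<1+∣p∣ p = +-mono-<-≤ 0<1 (0≤∣p∣ p)

-p≤∣p∣ : ∀ p → - p ≤ ∣ p ∣
-p≤∣p∣ p = subst (- p ≤_) (∣-p∣≡∣p∣ p) (p≤∣p∣ (- p))

∑-cong : ∀ {k} {f g : Fin k → ℚ} → (∀ i → f i ≡ g i) → ∑ f ≡ ∑ g
∑-cong {zero} h = refl
∑-cong {suc k} h = cong₂ _+_ (h zero) (∑-cong (λ i → h (suc i)))

∑-linear : ∀ {k} (α β : ℚ) (f g : Fin k → ℚ) →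
  ∑ (λ i → α * f i + β * g i) ≡ α * ∑ f + β * ∑ g
∑-linear {zero} α β f g = 0≡α*0+β*0 α β
  where
  0≡α*0+β*0 : ∀ α β → 0ℚ ≡ α * 0ℚ + β * 0ℚ
  0≡α*0+β*0 = solve-∀ ringQ
∑-linear {suc k} α β f g = trans
  (cong (α * f zero + β * g zero +_) (∑-linear α β (λ i → f (suc i)) (λ i → g (suc i))))
  (regroup α β (f zero) (g zero) _ _)
  where
  regroup : ∀ α β a b c d → α * a + β * b + (α * c + β * d) ≡ α * (a + c) + β * (b + d)
  regroup = solve-∀ ringQ

∑-distrib-+ : ∀ {k} (f g : Fin k → ℚ) → ∑ (λ i → f i + g i) ≡ ∑ f + ∑ g
∑-distrib-+ f g = trans (∑-cong (λ i → sym (unit (f i) (g i)))) (trans (∑-linear 1ℚ 1ℚ f g) (unit (∑ f) (∑ g)))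
  where
  unit : ∀ a b → 1ℚ * a + 1ℚ * b ≡ a + b
  unit = solve-∀ ringQ

∑-distribˡ-* : ∀ {k} (c : ℚ) (f : Fin k → ℚ) → ∑ (λ i → c * f i) ≡ c * ∑ f
∑-distribˡ-* c f = trans (∑-cong (λ i → sym (drop (f i)))) (trans (∑-linear c 0ℚ f f) (drop (∑ f)))
  where
  drop : ∀ a → c * a + 0ℚ * a ≡ c * a
  drop a = trans (cong (c * a +_) (*-zeroˡ a)) (+-identityʳ (c * a))

∑-zero : ∀ {k} → ∑ {k} (λ _ → 0ℚ) ≡ 0ℚ
∑-zero {zero} = refl
∑-zero {suc k} = cong (0ℚ +_) (∑-zero {k})

∑-comm : ∀ {k l} (f : Fin k → Fin l → ℚ) → ∑ (λ i → ∑ (λ j → f i j)) ≡ ∑ (λ j → ∑ (λ i → f i j))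
∑-comm {zero} {l} f = sym (∑-zero {l})
∑-comm {suc k} f = trans (cong (∑ (f zero) +_) (∑-comm (λ i → f (suc i))))
                         (sym (∑-distrib-+ (f zero) (λ j → ∑ (λ i → f (suc i) j))))

∑-mono-≤ : ∀ {k} {f g : Fin k → ℚ} → (∀ i → f i ≤ g i) → ∑ f ≤ ∑ g
∑-mono-≤ {zero} h = ≤-refl
∑-mono-≤ {suc k} h = +-mono-≤ (h zero) (∑-mono-≤ (λ i → h (suc i)))

∑-nonNeg : ∀ {k} {f : Fin k → ℚ} → (∀ i → 0ℚ ≤ f i) → 0ℚ ≤ ∑ f
∑-nonNeg {k} {f} h = subst (_≤ ∑ f) (∑-zero {k}) (∑-mono-≤ h)

term≤∑ : ∀ {k} {f : Fin k → ℚ} → (∀ i → 0ℚ ≤ f i) → ∀ i → f i ≤ ∑ f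
term≤∑ {suc k} {f} h zero =
  subst (_≤ ∑ f) (+-identityʳ (f zero)) (+-monoʳ-≤ (f zero) (∑-nonNeg (λ i → h (suc i))))
term≤∑ {suc k} {f} h (suc i) =
  subst (_≤ ∑ f) (+-identityˡ (f (suc i))) (+-mono-≤ (h zero) (term≤∑ (λ i → h (suc i)) i))

∑-nonNeg-≡0 : ∀ {k} {f : Fin k → ℚ} → (∀ i → 0ℚ ≤ f i) → ∑ f ≡ 0ℚ → ∀ i → f i ≡ 0ℚ
∑-nonNeg-≡0 h ∑≡0 i = ≤-antisym (subst (_ ≤_) ∑≡0 (term≤∑ h i)) (h i)

∑-splitAt : ∀ {m k} (h : Fin (m ℕ.+ k) → ℚ) → ∑ h ≡ ∑ (λ j → h (j ↑ˡ k)) + ∑ (λ j → h (m ↑ʳ j))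
∑-splitAt {zero} h = sym (+-identityˡ (∑ h))
∑-splitAt {suc m} {k} h = trans (cong (h zero +_) (∑-splitAt {m} {k} (λ i → h (suc i))))
                                (sym (+-assoc (h zero) _ _))

δ : ∀ {m} → Fin m → Fin m → ℚ
δ zero zero = 1ℚ
δ zero (suc _) = 0ℚ
δ (suc _) zero = 0ℚ
δ (suc k) (suc j) = δ k j

δ-nonNeg : ∀ {m} (k j : Fin m) → 0ℚ ≤ δ k j
δ-nonNeg zero zero = 0≤1
δ-nonNeg zero (suc j) = ≤-refl
δ-nonNeg (suc k) zero = ≤-refl
δ-nonNeg (suc k) (suc j) = δ-nonNeg k j

∑-δ : ∀ {m} (k : Fin m) (f : Fin m → ℚ) → ∑ (λ j → δ k j * f j) ≡ f k
∑-δ {suc m} zero f = trans (cong₂ _+_ (*-identityˡ (f zero)) ∑0) (+-identityʳ (f zero))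
  where
  ∑0 : ∑ (λ j → 0ℚ * f (suc j)) ≡ 0ℚ
  ∑0 = trans (∑-distribˡ-* 0ℚ (λ j → f (suc j))) (*-zeroˡ (∑ (λ j → f (suc j))))
∑-δ {suc m} (suc k) f = trans (cong₂ _+_ (*-zeroˡ (f zero)) (∑-δ k (λ j → f (suc j)))) (+-identityˡ _)

∑-δ≡1 : ∀ {m} (k : Fin m) → ∑ (δ k) ≡ 1ℚ
∑-δ≡1 k = trans (∑-cong (λ j → sym (*-identityʳ (δ k j)))) (∑-δ k (λ _ → 1ℚ))

lincomb : ∀ {m n} → (Fin m → ℚ) → (Fin m → Pt n) → Pt n
lincomb c a i = ∑ (λ j → c j * a j i)

≋-sym : ∀ {n} {a b : Pt n} → a ≋ b → b ≋ a
≋-sym h i = sym (h i)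

≋-trans : ∀ {n} {a b c : Pt n} → a ≋ b → b ≋ c → a ≋ c
≋-trans h g i = trans (h i) (g i)

⟪⟫-congˡ : ∀ {n} {φ ψ : Pt n} (a : Pt n) → φ ≋ ψ → ⟪ φ , a ⟫ ≡ ⟪ ψ , a ⟫
⟪⟫-congˡ a h = ∑-cong (λ i → cong (_* a i) (h i))

⟪⟫-congʳ : ∀ {n} (φ : Pt n) {a b : Pt n} → a ≋ b → ⟪ φ , a ⟫ ≡ ⟪ φ , b ⟫
⟪⟫-congʳ φ h = ∑-cong (λ i → cong (φ i *_) (h i))

⟪⟫-linearˡ : ∀ {n} (α β : ℚ) (φ ψ a : Pt n) →
  ⟪ (λ i → α * φ i + β * ψ i) , a ⟫ ≡ α * ⟪ φ , a ⟫ + β * ⟪ ψ , a ⟫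
⟪⟫-linearˡ α β φ ψ a =
  trans (∑-cong (λ i → distrib α β (φ i) (ψ i) (a i))) (∑-linear α β (λ i → φ i * a i) (λ i → ψ i * a i))
  where
  distrib : ∀ α β x y z → (α * x + β * y) * z ≡ α * (x * z) + β * (y * z)
  distrib = solve-∀ ringQ

⟪⟫-linearʳ : ∀ {n} (α β : ℚ) (φ a b : Pt n) →
  ⟪ φ , (λ i → α * a i + β * b i) ⟫ ≡ α * ⟪ φ , a ⟫ + β * ⟪ φ , b ⟫
⟪⟫-linearʳ α β φ a b =
  trans (∑-cong (λ i → distrib α β (φ i) (a i) (b i))) (∑-linear α β (λ i → φ i * a i) (λ i → φ i * b i))
  where
  distrib : ∀ α β x y z → x * (α * y + β * z) ≡ α * (x * y) + β * (x * z)
  distrib = solve-∀ ringQ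

⟪⟫-scaleˡ : ∀ {n} (α : ℚ) (φ a : Pt n) → ⟪ (λ i → α * φ i) , a ⟫ ≡ α * ⟪ φ , a ⟫
⟪⟫-scaleˡ α φ a = trans (∑-cong (λ i → *-assoc α (φ i) (a i))) (∑-distribˡ-* α (λ i → φ i * a i))

⟪⟫-scaleʳ : ∀ {n} (α : ℚ) (φ a : Pt n) → ⟪ φ , (λ i → α * a i) ⟫ ≡ α * ⟪ φ , a ⟫
⟪⟫-scaleʳ α φ a = trans (∑-cong (λ i → swap α (φ i) (a i))) (∑-distribˡ-* α (λ i → φ i * a i))
  where
  swap : ∀ α x y → x * (α * y) ≡ α * (x * y)
  swap = solve-∀ ringQ

⟪⟫-lincomb : ∀ {m n} (φ : Pt n) (c : Fin m → ℚ) (a : Fin m → Pt n) →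
  ⟪ φ , lincomb c a ⟫ ≡ ∑ (λ j → c j * ⟪ φ , a j ⟫)
⟪⟫-lincomb φ c a = begin
  ∑ (λ i → φ i * ∑ (λ j → c j * a j i))   ≡⟨ ∑-cong (λ i → sym (∑-distribˡ-* (φ i) (λ j → c j * a j i))) ⟩
  ∑ (λ i → ∑ (λ j → φ i * (c j * a j i))) ≡⟨ ∑-comm (λ i j → φ i * (c j * a j i)) ⟩
  ∑ (λ j → ∑ (λ i → φ i * (c j * a j i))) ≡⟨ ∑-cong (λ j → trans (∑-cong (λ i → swap (φ i) (c j) (a j i)))
                                                                 (∑-distribˡ-* (c j) (λ i → φ i * a j i))) ⟩
  ∑ (λ j → c j * ⟪ φ , a j ⟫)             ∎
  where
  open ≡-Reasoning
  swap : ∀ x y z → x * (y * z) ≡ y * (x * z)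
  swap = solve-∀ ringQ

⟪⟫-≋lincomb : ∀ {m n} (φ : Pt n) (c : Fin m → ℚ) (a : Fin m → Pt n) {x : Pt n} →
  x ≋ lincomb c a → ⟪ φ , x ⟫ ≡ ∑ (λ j → c j * ⟪ φ , a j ⟫)
⟪⟫-≋lincomb φ c a x≋ = trans (⟪⟫-congʳ φ x≋) (⟪⟫-lincomb φ c a)

lincomb-congʳ : ∀ {m n} (c : Fin m → ℚ) {a b : Fin m → Pt n} → (∀ j → a j ≋ b j) → lincomb c a ≋ lincomb c b
lincomb-congʳ c h i = ∑-cong (λ j → cong (c j *_) (h j i))

lincomb-lincomb : ∀ {k m n} (c : Fin k → ℚ) (w : Fin k → Fin m → ℚ) (V : Fin m → Pt n) →
  lincomb c (λ l → lincomb (w l) V) ≋ lincomb (λ j → ∑ (λ l → c l * w l j)) V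
lincomb-lincomb c w V i = begin
  ∑ (λ l → c l * ∑ (λ j → w l j * V j i))   ≡⟨ ∑-cong (λ l → sym (∑-distribˡ-* (c l) (λ j → w l j * V j i))) ⟩
  ∑ (λ l → ∑ (λ j → c l * (w l j * V j i))) ≡⟨ ∑-comm (λ l j → c l * (w l j * V j i)) ⟩
  ∑ (λ j → ∑ (λ l → c l * (w l j * V j i))) ≡⟨ ∑-cong (λ j → trans (∑-cong (λ l → rotate (c l) (w l j) (V j i)))
                                                                   (∑-distribˡ-* (V j i) (λ l → c l * w l j))) ⟩
  ∑ (λ j → V j i * ∑ (λ l → c l * w l j))   ≡⟨ ∑-cong (λ j → *-comm (V j i) _) ⟩
  ∑ (λ j → ∑ (λ l → c l * w l j) * V j i)   ∎
  where
  open ≡-Reasoning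
  rotate : ∀ x y z → x * (y * z) ≡ z * (x * y)
  rotate = solve-∀ ringQ

lincomb-linear : ∀ {m n} (α β : ℚ) (c d : Fin m → ℚ) (V : Fin m → Pt n) →
  (λ i → α * lincomb c V i + β * lincomb d V i) ≋ lincomb (λ j → α * c j + β * d j) V
lincomb-linear α β c d V i =
  trans (sym (∑-linear α β (λ j → c j * V j i) (λ j → d j * V j i))) (∑-cong (λ j → distrib α β (c j) (d j) (V j i)))
  where
  distrib : ∀ α β x y z → α * (x * z) + β * (y * z) ≡ (α * x + β * y) * z
  distrib = solve-∀ ringQ

lincomb-++ : ∀ {m k n} (c : Fin (m ℕ.+ k) → ℚ) (a : Fin m → Pt n) (b : Fin k → Pt n) →
  lincomb c (a ++ b) ≋ (λ i → lincomb (λ j → c (j ↑ˡ k)) a i + lincomb (λ j → c (m ↑ʳ j)) b i)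
lincomb-++ {m} {k} c a b i = trans (∑-splitAt {m} {k} (λ l → c l * (a ++ b) l i))
  (cong₂ _+_ (∑-cong (λ j → cong (λ v → c (j ↑ˡ k) * v i) (lookup-++ˡ a b j)))
             (∑-cong (λ j → cong (λ v → c (m ↑ʳ j) * v i) (lookup-++ʳ a b j))))

convex-≡1 : ∀ {t u v} → 0ℚ < t → t < 1ℚ → u ≤ 1ℚ → v ≤ 1ℚ → t * u + (1ℚ - t) * v ≡ 1ℚ → u ≡ 1ℚ × v ≡ 1ℚ
convex-≡1 {t} {u} {v} t>0 t<1 u≤1 v≤1 avg≡1 =
  ≤-antisym u≤1 (0≤q-p⇒p≤q (*-cancelˡ-≤-0< t>0 (subst₂ _≤_ (sym (*-zeroʳ t)) (sym u-gap)
    (*-nonNeg (p≤q⇒0≤q-p (<⇒≤ t<1)) (p≤q⇒0≤q-p v≤1))))) ,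
  ≤-antisym v≤1 (0≤q-p⇒p≤q (*-cancelˡ-≤-0< (p<q⇒0<q-p t<1) (subst₂ _≤_ (sym (*-zeroʳ (1ℚ - t))) (sym v-gap)
    (*-nonNeg (<⇒≤ t>0) (p≤q⇒0≤q-p u≤1)))))
  where
  u-gap-ring : ∀ t u v → t * (u - 1ℚ) ≡ (1ℚ - t) * (1ℚ - v) + (t * u + (1ℚ - t) * v - 1ℚ)
  u-gap-ring = solve-∀ ringQ
  v-gap-ring : ∀ t u v → (1ℚ - t) * (v - 1ℚ) ≡ t * (1ℚ - u) + (t * u + (1ℚ - t) * v - 1ℚ)
  v-gap-ring = solve-∀ ringQ
  +[1-1] : ∀ a → a + (1ℚ - 1ℚ) ≡ a
  +[1-1] = solve-∀ ringQ
  u-gap : t * (u - 1ℚ) ≡ (1ℚ - t) * (1ℚ - v)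
  u-gap = trans (u-gap-ring t u v) (trans (cong (λ w → (1ℚ - t) * (1ℚ - v) + (w - 1ℚ)) avg≡1) (+[1-1] _))
  v-gap : (1ℚ - t) * (v - 1ℚ) ≡ t * (1ℚ - u)
  v-gap = trans (v-gap-ring t u v) (trans (cong (λ w → t * (1ℚ - u) + (w - 1ℚ)) avg≡1) (+[1-1] _))

argmin : ∀ {m} (Q : Fin m → Set) → (∀ j → Dec (Q j)) → (g : Fin m → ℚ) →
  (∀ j → ¬ Q j) ⊎ Σ (Fin m) λ j₀ → Q j₀ × (∀ j → Q j → g j₀ ≤ g j)
argmin {zero} Q Q? g = inj₁ (λ ())
argmin {suc m} Q Q? g with argmin (λ j → Q (suc j)) (λ j → Q? (suc j)) (λ j → g (suc j)) | Q? zero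
... | inj₁ none | no ¬q = inj₁ λ { zero → ¬q ; (suc j) → none j }
... | inj₁ none | yes q = inj₂ (zero , q , λ { zero _ → ≤-refl ; (suc j) qj → ⊥-elim (none j qj) })
... | inj₂ (j₀ , q₀ , min) | no ¬q = inj₂ (suc j₀ , q₀ , λ { zero qz → ⊥-elim (¬q qz) ; (suc j) qj → min j qj })
... | inj₂ (j₀ , q₀ , min) | yes q with g zero ≤? g (suc j₀)
...   | yes g₀≤ = inj₂ (zero , q , λ { zero _ → ≤-refl ; (suc j) qj → ≤-trans g₀≤ (min j qj) })
...   | no g₀≰ = inj₂ (suc j₀ , q₀ , λ { zero _ → <⇒≤ (≰⇒> g₀≰) ; (suc j) qj → min j qj })

positiveLowerBound : ∀ {m} (Q : Fin m → Set) → (∀ j → Dec (Q j)) → (g : Fin m → ℚ) → (∀ j → Q j → 0ℚ < g j) →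
  Σ ℚ λ ε → 0ℚ < ε × (∀ j → Q j → ε ≤ g j)
positiveLowerBound Q Q? g g>0 with argmin Q Q? g
... | inj₁ none = 1ℚ , 0<1 , λ j q → ⊥-elim (none j q)
... | inj₂ (j₀ , q₀ , min) = g j₀ , g>0 j₀ q₀ , min

/1≡mkℚ : ∀ z → z / 1 ≡ mkℚ z 0 (Coprime.sym (1-coprimeTo ℤ.∣ z ∣))
/1≡mkℚ z = fromℚᵘ-toℚᵘ (mkℚ z 0 (Coprime.sym (1-coprimeTo ℤ.∣ z ∣)))

IsInt-/1 : ∀ z → IsInt (z / 1)
IsInt-/1 z = z , refl

IsInt-0 : IsInt 0ℚ
IsInt-0 = IsInt-/1 (ℤ.+ 0)

IsInt-1 : IsInt 1ℚ
IsInt-1 = IsInt-/1 (ℤ.+ 1)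

IsInt-+ : ∀ {p q} → IsInt p → IsInt q → IsInt (p + q)
IsInt-+ (z , refl) (w , refl) rewrite /1≡mkℚ z | /1≡mkℚ w = z ℤ.* ℤ.+ 1 ℤ.+ w ℤ.* ℤ.+ 1 , refl

IsInt-* : ∀ {p q} → IsInt p → IsInt q → IsInt (p * q)
IsInt-* (z , refl) (w , refl) rewrite /1≡mkℚ z | /1≡mkℚ w = z ℤ.* w , refl

IsInt-neg : ∀ {p} → IsInt p → IsInt (- p)
IsInt-neg {p} h = subst IsInt (-1*p≡-p p) (IsInt-* (IsInt-/1 (ℤ.- ℤ.+ 1)) h)
  where
  -1*p≡-p : ∀ p → - 1ℚ * p ≡ - p
  -1*p≡-p = solve-∀ ringQ

IsInt-- : ∀ {p q} → IsInt p → IsInt q → IsInt (p - q)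
IsInt-- hp hq = IsInt-+ hp (IsInt-neg hq)

IsInt-∑ : ∀ {k} {f : Fin k → ℚ} → (∀ i → IsInt (f i)) → IsInt (∑ f)
IsInt-∑ {zero} h = IsInt-0
IsInt-∑ {suc k} h = IsInt-+ (h zero) (IsInt-∑ (λ i → h (suc i)))

archimedean : ∀ q → Σ ℕ λ N → q ≤ ℤ.+ N / 1
archimedean (mkℚ (ℤ.+ n) d c) = n ,
  subst (mkℚ (ℤ.+ n) d c ≤_) (sym (/1≡mkℚ (ℤ.+ n))) (*≤* (ℤ.*-monoˡ-≤-nonNeg (ℤ.+ n) (ℤ.+≤+ (ℕ.s≤s ℕ.z≤n))))
archimedean q@(mkℚ ℤ.-[1+ n ] d c) = 0 , nonPositive⁻¹ q

den-positive : ∀ q → 0ℚ < ℤ.+ ↧ₙ q / 1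
den-positive (mkℚ z d c) = positive⁻¹ _ {{normalize-pos (suc d) 1}}

den*q-IsInt : ∀ q → IsInt ((ℤ.+ ↧ₙ q / 1) * q)
den*q-IsInt (mkℚ z d c) = z , trans (cong (_* mkℚ z d c) (/1≡mkℚ (ℤ.+ suc d)))
  (fromℚᵘ-cong {ℚᵘ.mkℚᵘ (ℤ.+ suc d ℤ.* z) (d ℕ.+ 0 ℕ.* suc d)} {ℚᵘ.mkℚᵘ z 0}
    (ℚᵘ.*≡* (trans (ℤ.*-identityʳ _) (trans (ℤ.*-comm (ℤ.+ suc d) z) (cong (λ k → z ℤ.* ℤ.+ suc k) (sym (ℕ.+-identityʳ d)))))))

commonDenominator : ∀ {k} (q : Fin k → ℚ) → Σ ℚ λ D → 0ℚ < D × IsInt D × (∀ i → IsInt (D * q i))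
commonDenominator {zero} q = 1ℚ , 0<1 , IsInt-1 , λ ()
commonDenominator {suc k} q with commonDenominator (λ i → q (suc i))
... | D , D>0 , D∈ℤ , Dq∈ℤ = d * D , *-pos (den-positive (q zero)) D>0 , IsInt-* d∈ℤ D∈ℤ , integral
  where
  d = ℤ.+ ↧ₙ q zero / 1
  d∈ℤ : IsInt d
  d∈ℤ = IsInt-/1 (ℤ.+ ↧ₙ q zero)
  reassoc : ∀ d D x → D * (d * x) ≡ d * D * x
  reassoc = solve-∀ ringQ
  integral : ∀ i → IsInt (d * D * q i)
  integral zero = subst IsInt (reassoc d D (q zero)) (IsInt-* D∈ℤ (den*q-IsInt (q zero)))
  integral (suc i) = subst IsInt (sym (*-assoc d D (q (suc i)))) (IsInt-* d∈ℤ (Dq∈ℤ i))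

commonDenominator² : ∀ {m n} (V : Fin m → Pt n) →
  Σ ℚ λ D → 0ℚ < D × IsInt D × (∀ j i → IsInt (D * V j i))
commonDenominator² {zero} V = 1ℚ , 0<1 , IsInt-1 , λ ()
commonDenominator² {suc m} V with commonDenominator (V zero) | commonDenominator² (λ j → V (suc j))
... | D₀ , D₀>0 , D₀∈ℤ , D₀V∈ℤ | D , D>0 , D∈ℤ , DV∈ℤ = D₀ * D , *-pos D₀>0 D>0 , IsInt-* D₀∈ℤ D∈ℤ , integral
  where
  reassoc : ∀ a b x → b * (a * x) ≡ a * b * x
  reassoc = solve-∀ ringQ
  integral : ∀ j i → IsInt (D₀ * D * V j i)
  integral zero i = subst IsInt (reassoc D₀ D (V zero i)) (IsInt-* D∈ℤ (D₀V∈ℤ i))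
  integral (suc j) i = subst IsInt (sym (*-assoc D₀ D (V (suc j) i))) (IsInt-* D₀∈ℤ (DV∈ℤ j i))

-- Farkas' lemma

all⊎any : ∀ {m} {A B : Fin m → Set} → (∀ j → A j ⊎ B j) → (∀ j → A j) ⊎ ∃ B
all⊎any {zero} h = inj₁ (λ ())
all⊎any {suc m} {A} {B} h with h zero | all⊎any {m} {λ j → A (suc j)} {λ j → B (suc j)} (λ j → h (suc j))
... | inj₂ b | _ = inj₂ (zero , b)
... | inj₁ a | inj₂ (j , b) = inj₂ (suc j , b)
... | inj₁ a | inj₁ as = inj₁ λ { zero → a ; (suc j) → as j }

NonNegCombination : ∀ {m d} → (Fin m → Pt d) → Pt d → Set
NonNegCombination {m} a b = Σ (Fin m → ℚ) λ c → (∀ j → 0ℚ ≤ c j) × (b ≋ lincomb c a)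

Separator : ∀ {m d} → (Fin m → Pt d) → Pt d → Set
Separator {m} {d} a b = Σ (Pt d) λ y → (∀ j → 0ℚ ≤ ⟪ y , a j ⟫) × (⟪ y , b ⟫ < 0ℚ)

p≢0⇒0<p*p : ∀ p → p ≢ 0ℚ → 0ℚ < p * p
p≢0⇒0<p*p p p≢0 with <-cmp p 0ℚ
... | tri< p<0 _ _ = subst (0ℚ <_) (neg*neg p) (*-pos (neg-antimono-< p<0) (neg-antimono-< p<0))
  where
  neg*neg : ∀ p → (- p) * (- p) ≡ p * p
  neg*neg = solve-∀ ringQ
... | tri≈ _ p≡0 _ = ⊥-elim (p≢0 p≡0)
... | tri> _ _ p>0 = *-pos p>0 p>0

0≤p*p : ∀ p → 0ℚ ≤ p * p
0≤p*p p with p ≟ 0ℚ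
... | yes refl = ≤-refl
... | no p≢0 = <⇒≤ (p≢0⇒0<p*p p p≢0)

0<⟪b,b⟫ : ∀ {d} (b : Pt d) i → b i ≢ 0ℚ → 0ℚ < ⟪ b , b ⟫
0<⟪b,b⟫ b i bi≢0 = <-≤-trans (p≢0⇒0<p*p (b i) bi≢0) (term≤∑ (λ i → 0≤p*p (b i)) i)

farkas-empty : ∀ {d} (a : Fin 0 → Pt d) b → NonNegCombination a b ⊎ Separator a b
farkas-empty {d} a b with all? (λ i → b i ≟ 0ℚ)
... | yes b≡0 = inj₁ ((λ ()) , (λ ()) , b≡0)
... | no b≢0 with ¬∀⟶∃¬ d (λ i → b i ≡ 0ℚ) (λ i → b i ≟ 0ℚ) b≢0
...   | i , bi≢0 = inj₂ ((λ i → - 1ℚ * b i) , (λ ()) , ⟪-b,b⟫<0)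
  where
  ⟪-b,b⟫<0 : ⟪ (λ i → - 1ℚ * b i) , b ⟫ < 0ℚ
  ⟪-b,b⟫<0 = subst (_< 0ℚ) (trans (-p≡-1*p _) (sym (⟪⟫-scaleˡ (- 1ℚ) b b))) (neg-antimono-< (0<⟪b,b⟫ b i bi≢0))
    where
    -p≡-1*p : ∀ p → - p ≡ - 1ℚ * p
    -p≡-1*p = solve-∀ ringQ

solve-for-b : ∀ (γ B B⁻¹ S x b C : ℚ) → B * B⁻¹ ≡ 1ℚ → γ * x + B * b ≡ S * x + B * C →
  b ≡ (S - γ) * B⁻¹ * x + C
solve-for-b γ B B⁻¹ S x b C BB⁻¹≡1 eq = begin
  b                                                           ≡⟨ expand γ B B⁻¹ S x b C ⟩
  (S - γ) * B⁻¹ * x + C + (1ℚ - B * B⁻¹) * (b - C) + B⁻¹ * (L - R) ≡⟨ cong₂ (λ u v → (S - γ) * B⁻¹ * x + C + (1ℚ - u) * (b - C) + B⁻¹ * (v - R)) BB⁻¹≡1 eq ⟩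
  (S - γ) * B⁻¹ * x + C + (1ℚ - 1ℚ) * (b - C) + B⁻¹ * (R - R)  ≡⟨ collapse ((S - γ) * B⁻¹ * x + C) (b - C) B⁻¹ R ⟩
  (S - γ) * B⁻¹ * x + C                                       ∎
  where
  open ≡-Reasoning
  L = γ * x + B * b
  R = S * x + B * C
  expand : ∀ γ B B⁻¹ S x b C → b ≡ (S - γ) * B⁻¹ * x + C + (1ℚ - B * B⁻¹) * (b - C) + B⁻¹ * ((γ * x + B * b) - (S * x + B * C))
  expand = solve-∀ ringQ
  collapse : ∀ u v w r → u + (1ℚ - 1ℚ) * v + w * (r - r) ≡ u
  collapse = solve-∀ ringQ

-- Fourier–Motzkin elimination of the generator a₀, used when the separator y of
-- the remaining generators a′ has ⟪ y , a₀ ⟫ < 0.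
module FourierMotzkin {m d} (a : Fin (suc m) → Pt d) (b y : Pt d)
  (y-sep : ∀ j → 0ℚ ≤ ⟪ y , a (suc j) ⟫) (y-b : ⟪ y , b ⟫ < 0ℚ) (y-a₀ : ⟪ y , a zero ⟫ < 0ℚ) where

  a₀ : Pt d
  a₀ = a zero

  a′ : Fin m → Pt d
  a′ j = a (suc j)

  B γ : ℚ
  B = - ⟪ y , a₀ ⟫
  γ = ⟪ y , b ⟫

  B>0 : 0ℚ < B
  B>0 = neg-antimono-< y-a₀

  α : Fin m → ℚ
  α j = ⟪ y , a′ j ⟫

  a″ : Fin m → Pt d
  a″ j i = α j * a₀ i + B * a′ j i

  b″ : Pt d
  b″ i = γ * a₀ i + B * b i

  cone-lift : NonNegCombination a″ b″ → NonNegCombination a b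
  cone-lift (c , c≥0 , b″≋) = c′ , c′≥0 , b≋
    where
    S = ∑ (λ j → c j * α j)
    c′ : Fin (suc m) → ℚ
    c′ = (S - γ) * recip B ∷ c
    S-γ≥0 : 0ℚ ≤ S - γ
    S-γ≥0 = +-mono-≤ (∑-nonNeg (λ j → *-nonNeg (c≥0 j) (y-sep j))) (neg-antimono-≤ (<⇒≤ y-b))
    c′≥0 : ∀ j → 0ℚ ≤ c′ j
    c′≥0 zero = *-nonNeg S-γ≥0 (<⇒≤ (recip-pos B>0))
    c′≥0 (suc j) = c≥0 j
    lincomb-a″ : ∀ i → lincomb c a″ i ≡ S * a₀ i + B * lincomb c a′ i
    lincomb-a″ i = trans (∑-cong (λ j → distrib (c j) (α j) (a₀ i) B (a′ j i)))
                         (trans (∑-linear (a₀ i) B (λ j → c j * α j) (λ j → c j * a′ j i))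
                                (cong (_+ B * lincomb c a′ i) (*-comm (a₀ i) S)))
      where
      distrib : ∀ c α x B z → c * (α * x + B * z) ≡ x * (c * α) + B * (c * z)
      distrib = solve-∀ ringQ
    b≋ : b ≋ lincomb c′ a
    b≋ i = solve-for-b γ B (recip B) S (a₀ i) (b i) (lincomb c a′ i) (*-recipʳ B (0<p⇒p≢0 B>0))
                       (trans (b″≋ i) (lincomb-a″ i))

  separator-lift : Separator a″ b″ → Separator a b
  separator-lift (y′ , y′-sep , y′-b) = y″ , y″-sep , y″-b
    where
    κ = ⟪ y′ , a₀ ⟫
    y″ : Pt d
    y″ i = κ * y i + B * y′ i
    comm : ∀ x κ B z → x * κ + B * z ≡ κ * x + B * z
    comm = solve-∀ ringQ
    y″-sep : ∀ j → 0ℚ ≤ ⟪ y″ , a j ⟫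
    y″-sep zero = subst (0ℚ ≤_) (sym (trans (⟪⟫-linearˡ κ B y y′ a₀) (cancel κ ⟪ y , a₀ ⟫))) ≤-refl
      where
      cancel : ∀ κ β → κ * β + (- β) * κ ≡ 0ℚ
      cancel = solve-∀ ringQ
    y″-sep (suc j) = subst (0ℚ ≤_) (trans (⟪⟫-linearʳ (α j) B y′ a₀ (a′ j))
                                    (trans (comm (α j) κ B ⟪ y′ , a′ j ⟫) (sym (⟪⟫-linearˡ κ B y y′ (a′ j)))))
                          (y′-sep j)
    y″-b : ⟪ y″ , b ⟫ < 0ℚ
    y″-b = subst (_< 0ℚ) (trans (⟪⟫-linearʳ γ B y′ a₀ b)
                         (trans (comm γ κ B ⟪ y′ , b ⟫) (sym (⟪⟫-linearˡ κ B y y′ b))))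
                 y′-b

farkas : ∀ {d} m (a : Fin m → Pt d) (b : Pt d) → NonNegCombination a b ⊎ Separator a b
farkas zero a b = farkas-empty a b
farkas (suc m) a b with farkas m (λ j → a (suc j)) b
... | inj₁ (c , c≥0 , b≋) = inj₁ ((0ℚ ∷ c) , c′≥0 , λ i → trans (b≋ i) (sym (drop-a₀ i)))
  where
  c′≥0 : ∀ j → 0ℚ ≤ (0ℚ ∷ c) j
  c′≥0 zero = ≤-refl
  c′≥0 (suc j) = c≥0 j
  drop-a₀ : ∀ i → 0ℚ * a zero i + lincomb c (λ j → a (suc j)) i ≡ lincomb c (λ j → a (suc j)) i
  drop-a₀ i = trans (cong (_+ lincomb c (λ j → a (suc j)) i) (*-zeroˡ (a zero i))) (+-identityˡ _)
... | inj₂ (y , y-sep , y-b) with 0ℚ ≤? ⟪ y , a zero ⟫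
...   | yes y-a₀ = inj₂ (y , (λ { zero → y-a₀ ; (suc j) → y-sep j }) , y-b)
...   | no ¬y-a₀ = Sum.map cone-lift separator-lift (farkas m a″ b″)
  where open FourierMotzkin a b y y-sep y-b (≰⇒> ¬y-a₀)

module Polytope {n m : ℕ} (V : Fin m → Pt n) where

  Feasible : Pt n → Set
  Feasible φ = ∀ j → ⟪ φ , V j ⟫ ≤ 1ℚ

  vertex∈P : ∀ k → InP V (V k)
  vertex∈P k = δ k , δ-nonNeg k , ∑-δ≡1 k , λ i → sym (∑-δ k (λ j → V j i))

  vertex∈lin : ∀ k → LinP V (V k)
  vertex∈lin k = 1 , (λ _ → V k) , (λ _ → 1ℚ) , (λ _ → vertex∈P k) , λ i → x≡1*x+0 (V k i)
    where
    x≡1*x+0 : ∀ x → x ≡ 1ℚ * x + 0ℚ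
    x≡1*x+0 = solve-∀ ringQ

  ∑-*-≤1 : ∀ (φ : Pt n) (w : Fin m → ℚ) → Feasible φ → (∀ j → 0ℚ ≤ w j) →
    ∑ (λ j → w j * ⟪ φ , V j ⟫) ≤ ∑ w
  ∑-*-≤1 φ w feasible w≥0 =
    subst (∑ (λ j → w j * ⟪ φ , V j ⟫) ≤_) (∑-cong (λ j → *-identityʳ (w j))) (∑-mono-≤ (λ j → *-monoˡ-≤-0≤ (w≥0 j) (feasible j)))

  Feasible⇒InDual : ∀ φ → Feasible φ → InDual V φ
  Feasible⇒InDual φ feasible a (w , w≥0 , ∑w≡1 , a≋) =
    subst₂ _≤_ (sym (⟪⟫-≋lincomb φ w V a≋)) ∑w≡1 (∑-*-≤1 φ w feasible w≥0)

  InDual⇒Feasible : ∀ φ → InDual V φ → Feasible φ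
  InDual⇒Feasible φ φ∈P^∨ j = φ∈P^∨ (V j) (vertex∈P j)

  agreeOnVertices⇒agreeOnP : ∀ (ψ₁ ψ₂ : Pt n) → (∀ j → ⟪ ψ₁ , V j ⟫ ≡ ⟪ ψ₂ , V j ⟫) → ∀ a → InP V a → ⟪ ψ₁ , a ⟫ ≡ ⟪ ψ₂ , a ⟫
  agreeOnVertices⇒agreeOnP ψ₁ ψ₂ agree a (w , _ , _ , a≋) =
    trans (⟪⟫-≋lincomb ψ₁ w V a≋) (trans (∑-cong (λ j → cong (w j *_) (agree j))) (sym (⟪⟫-≋lincomb ψ₂ w V a≋)))

  agreeOnVertices⇒SameOnLin : ∀ (ψ₁ ψ₂ : Pt n) → (∀ j → ⟪ ψ₁ , V j ⟫ ≡ ⟪ ψ₂ , V j ⟫) → SameOnLin V ψ₁ ψ₂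
  agreeOnVertices⇒SameOnLin ψ₁ ψ₂ agree a (k , p , c , p∈P , a≋) =
    trans (⟪⟫-≋lincomb ψ₁ c p a≋) (trans (∑-cong (λ l → cong (c l *_) (agreeOnVertices⇒agreeOnP ψ₁ ψ₂ agree (p l) (p∈P l))))
                                     (sym (⟪⟫-≋lincomb ψ₂ c p a≋)))

  LinP⇒lincomb : ∀ {a} → LinP V a → Σ (Fin m → ℚ) λ e → a ≋ lincomb e V
  LinP⇒lincomb (k , p , c , p∈P , a≋) =
    (λ j → ∑ (λ l → c l * weights l j)) ,
    ≋-trans a≋ (≋-trans (lincomb-congʳ c (λ l → proj₂ (proj₂ (proj₂ (p∈P l))))) (lincomb-lincomb c weights V))
    where
    weights : Fin k → Fin m → ℚ
    weights l = proj₁ (p∈P l)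

  ComplementarySlack : Pt n → (Fin m → ℚ) → Set
  ComplementarySlack φ ν = ∀ j → ν j * ⟪ φ , V j ⟫ ≡ ν j

  slack⇒⟪⟫≡∑ : ∀ φ ν {x} → ComplementarySlack φ ν → x ≋ lincomb ν V → ⟪ φ , x ⟫ ≡ ∑ ν
  slack⇒⟪⟫≡∑ φ ν slack x≋ = trans (⟪⟫-≋lincomb φ ν V x≋) (∑-cong slack)

  InCone-cong : ∀ {x x′ h h′} → x ≋ x′ → h ≡ h′ → InCone V (x , h) → InCone V (x′ , h′)
  InCone-cong x≋x′ refl (t , a , t≥0 , a∈P , x≋ta , h≡t) = t , a , t≥0 , a∈P , ≋-trans (≋-sym x≋x′) x≋ta , h≡t

  InCone⇒LinP : ∀ {x h} → InCone V (x , h) → LinP V x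
  InCone⇒LinP (t , a , _ , a∈P , x≋ta , _) =
    1 , (λ _ → a) , (λ _ → t) , (λ _ → a∈P) , λ i → trans (x≋ta i) (sym (+-identityʳ (t * a i)))

  InCone⇒lincomb : ∀ {x h} → InCone V (x , h) →
    Σ (Fin m → ℚ) λ ν → (∀ j → 0ℚ ≤ ν j) × (x ≋ lincomb ν V) × (∑ ν ≡ h)
  InCone⇒lincomb (t , a , t≥0 , (w , w≥0 , ∑w≡1 , a≋) , x≋ta , refl) =
    (λ j → t * w j) , (λ j → *-nonNeg t≥0 (w≥0 j)) , x≋ ,
    trans (∑-distribˡ-* t w) (trans (cong (t *_) ∑w≡1) (*-identityʳ t))
    where
    x≋ : _ ≋ lincomb (λ j → t * w j) V
    x≋ i = trans (x≋ta i) (trans (cong (t *_) (a≋ i))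
                 (trans (sym (∑-distribˡ-* t (λ j → w j * V j i))) (∑-cong (λ j → sym (*-assoc t (w j) (V j i))))))

  Feasible⇒≤height : ∀ φ {x h} → Feasible φ → InCone V (x , h) → ⟪ φ , x ⟫ ≤ h
  Feasible⇒≤height φ feasible x∈C with InCone⇒lincomb x∈C
  ... | ν , ν≥0 , x≋ , ∑ν≡h = subst₂ _≤_ (sym (⟪⟫-≋lincomb φ ν V x≋)) ∑ν≡h (∑-*-≤1 φ ν feasible ν≥0)

  module _ (0∈P : InP V zeroPt) where

    lincomb⇒InCone : ∀ {x} (ν : Fin m → ℚ) → (∀ j → 0ℚ ≤ ν j) → x ≋ lincomb ν V → InCone V (x , ∑ ν)
    lincomb⇒InCone {x} ν ν≥0 x≋ with ∑ ν ≟ 0ℚ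
    ... | yes ∑ν≡0 = 0ℚ , zeroPt , ≤-refl , 0∈P , x≋0 , ∑ν≡0
      where
      x≋0 : x ≋ (0ℚ • zeroPt)
      x≋0 i = trans (x≋ i) (trans (∑-cong (λ j → trans (cong (_* V j i) (∑-nonNeg-≡0 ν≥0 ∑ν≡0 j)) (*-zeroˡ (V j i))))
                                  (∑-zero {m}))
    ... | no ∑ν≢0 = s , (λ i → recip s * x i) , <⇒≤ s>0 , x/s∈P , x≋s•x/s , refl
      where
      s = ∑ ν
      s>0 : 0ℚ < s
      s>0 = ≤∧≢⇒< (∑-nonNeg ν≥0) (λ 0≡s → ∑ν≢0 (sym 0≡s))
      x/s∈P : InP V (λ i → recip s * x i)
      x/s∈P = (λ j → recip s * ν j) , (λ j → *-nonNeg (<⇒≤ (recip-pos s>0)) (ν≥0 j)) ,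
              trans (∑-distribˡ-* (recip s) ν) (trans (*-comm (recip s) s) (*-recipʳ s ∑ν≢0)) ,
              λ i → trans (cong (recip s *_) (x≋ i))
                          (trans (sym (∑-distribˡ-* (recip s) (λ j → ν j * V j i)))
                                 (∑-cong (λ j → sym (*-assoc (recip s) (ν j) (V j i)))))
      x≋s•x/s : x ≋ (s • (λ i → recip s * x i))
      x≋s•x/s i = trans (sym (*-identityˡ (x i))) (trans (cong (_* x i) (sym (*-recipʳ s ∑ν≢0))) (*-assoc s (recip s) (x i)))

    -- Add H − h times a convex representation of 0 ∈ P.
    InCone-raise : ∀ {x h H} → InCone V (x , h) → h ≤ H → InCone V (x , H)
    InCone-raise {x} {h} {H} x∈C h≤H with InCone⇒lincomb x∈C
    ... | ν , ν≥0 , x≋ , ∑ν≡h =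
      InCone-cong (λ _ → refl) ∑ν′≡H (lincomb⇒InCone ν′ ν′≥0 x≋′)
      where
      w₀ = proj₁ 0∈P
      w₀≥0 = proj₁ (proj₂ 0∈P)
      ∑w₀≡1 = proj₁ (proj₂ (proj₂ 0∈P))
      0≋ = proj₂ (proj₂ (proj₂ 0∈P))
      ν′ : Fin m → ℚ
      ν′ j = 1ℚ * ν j + (H - h) * w₀ j
      ν′≥0 : ∀ j → 0ℚ ≤ ν′ j
      ν′≥0 j = +-mono-≤ (*-nonNeg 0≤1 (ν≥0 j)) (*-nonNeg (p≤q⇒0≤q-p h≤H) (w₀≥0 j))
      x≋′ : x ≋ lincomb ν′ V
      x≋′ i = trans (x≋ i) (trans (pad (lincomb ν V i) (H - h))
                    (trans (cong (λ z → 1ℚ * lincomb ν V i + (H - h) * z) (0≋ i)) (lincomb-linear 1ℚ (H - h) ν w₀ V i)))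
        where
        pad : ∀ a b → a ≡ 1ℚ * a + b * 0ℚ
        pad = solve-∀ ringQ
      ∑ν′≡H : ∑ ν′ ≡ H
      ∑ν′≡H = trans (∑-linear 1ℚ (H - h) ν w₀) (trans (cong₂ (λ a b → 1ℚ * a + (H - h) * b) ∑ν≡h ∑w₀≡1) (cancel h H))
        where
        cancel : ∀ h H → 1ℚ * h + (H - h) * 1ℚ ≡ H
        cancel = solve-∀ ringQ

true≢false : true ≢ false
true≢false ()

_⊆ᵇ_ : ∀ {m} → (Fin m → Bool) → (Fin m → Bool) → Set
T ⊆ᵇ T′ = ∀ j → T j ≡ true → T′ j ≡ true

countFalse : ∀ {m} → (Fin m → Bool) → ℕ
countFalse {zero} T = 0
countFalse {suc m} T = (if T zero then 0 else 1) ℕ.+ countFalse (λ j → T (suc j))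

countFalse-antimono : ∀ {m} {T T′ : Fin m → Bool} → T ⊆ᵇ T′ → countFalse T′ ℕ.≤ countFalse T
countFalse-antimono {zero} _ = ℕ.z≤n
countFalse-antimono {suc m} {T} {T′} T⊆T′ with T zero in T₀ | T′ zero in T′₀
... | true | true = countFalse-antimono (λ j → T⊆T′ (suc j))
... | true | false = ⊥-elim (true≢false (trans (sym (T⊆T′ zero T₀)) T′₀))
... | false | true = ℕ.m≤n⇒m≤1+n (countFalse-antimono (λ j → T⊆T′ (suc j)))
... | false | false = ℕ.s≤s (countFalse-antimono (λ j → T⊆T′ (suc j)))

countFalse-< : ∀ {m} {T T′ : Fin m → Bool} → T ⊆ᵇ T′ → ∀ j → T j ≡ false → T′ j ≡ true →
  countFalse T′ ℕ.< countFalse T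
countFalse-< {suc m} {T} {T′} T⊆T′ zero Tj Tj′ rewrite Tj | Tj′ =
  ℕ.s≤s (countFalse-antimono (λ j → T⊆T′ (suc j)))
countFalse-< {suc m} {T} {T′} T⊆T′ (suc j) Tj Tj′ with T zero in T₀ | T′ zero in T′₀
... | true | true = countFalse-< (λ j → T⊆T′ (suc j)) j Tj Tj′
... | true | false = ⊥-elim (true≢false (trans (sym (T⊆T′ zero T₀)) T′₀))
... | false | true = ℕ.m≤n⇒m≤1+n (countFalse-< (λ j → T⊆T′ (suc j)) j Tj Tj′)
... | false | false = ℕ.s≤s (countFalse-< (λ j → T⊆T′ (suc j)) j Tj Tj′)

indicator : ∀ {m} → (Fin m → Bool) → Fin m → ℚ
indicator T j = if T j then 1ℚ else 0ℚ

indicator-true : ∀ {m} (T : Fin m → Bool) j → T j ≡ true → indicator T j ≡ 1ℚ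
indicator-true T j Tj rewrite Tj = refl

indicator-false : ∀ {m} (T : Fin m → Bool) j → T j ≡ false → indicator T j ≡ 0ℚ
indicator-false T j Tj rewrite Tj = refl

indicator-nonNeg : ∀ {m} (T : Fin m → Bool) j → 0ℚ ≤ indicator T j
indicator-nonNeg T j with T j
... | true = 0≤1
... | false = ≤-refl

indicator-IsInt : ∀ {m} (T : Fin m → Bool) j → IsInt (indicator T j)
indicator-IsInt T j with T j
... | true = IsInt-1
... | false = IsInt-0

supported-shift-nonNeg : ∀ {m} (T : Fin m → Bool) (e : Fin m → ℚ) → (∀ j → T j ≡ false → e j ≡ 0ℚ) →
  ∀ {D} → 0ℚ < D → Σ ℚ λ N → IsInt N × (∀ j → 0ℚ ≤ 1ℚ * e j + N * (indicator T j * D))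
supported-shift-nonNeg T e e≡0 {D} D>0 =
  let N , S/D≤N = archimedean (S * recip D) in ℤ.+ N / 1 , IsInt-/1 (ℤ.+ N) , shifted≥0 (ℤ.+ N / 1) S/D≤N
  where
  S = ∑ (λ j → ∣ e j ∣)
  shifted≥0 : ∀ N → S * recip D ≤ N → ∀ j → 0ℚ ≤ 1ℚ * e j + N * (indicator T j * D)
  shifted≥0 N S/D≤N j with T j in Tj
  ... | true = subst (0ℚ ≤_) (rearrange (e j) N D) (p≤q⇒0≤q-p -e≤ND)
    where
    rearrange : ∀ e N D → N * D - (- e) ≡ 1ℚ * e + N * (1ℚ * D)
    rearrange = solve-∀ ringQ
    -e≤ND : - e j ≤ N * D
    -e≤ND = ≤-trans (-p≤∣p∣ (e j)) (≤-trans (term≤∑ (λ j → 0≤∣p∣ (e j)) j)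
              (subst₂ _≤_ (*-recip-cancelˡ D S (0<p⇒p≢0 D>0)) (*-comm D N) (*-monoˡ-≤-0≤ (<⇒≤ D>0) S/D≤N)))
  ... | false rewrite e≡0 j Tj = ≤-reflexive (sym (vanish N D))
    where
    vanish : ∀ N D → 1ℚ * 0ℚ + N * (0ℚ * D) ≡ 0ℚ
    vanish = solve-∀ ringQ

-- Vertices of P^∨

module Vertices {n m : ℕ} (V : Fin m → Pt n) where
  open Polytope V

  tightAt : Pt n → Fin m → Bool
  tightAt φ j = does (⟪ φ , V j ⟫ ≟ 1ℚ)

  tightAt⇒≡1 : ∀ φ j → tightAt φ j ≡ true → ⟪ φ , V j ⟫ ≡ 1ℚ
  tightAt⇒≡1 φ j _ with ⟪ φ , V j ⟫ ≟ 1ℚ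
  ... | yes ≡1 = ≡1

  ≡1⇒tightAt : ∀ φ j → ⟪ φ , V j ⟫ ≡ 1ℚ → tightAt φ j ≡ true
  ≡1⇒tightAt φ j ≡1 with ⟪ φ , V j ⟫ ≟ 1ℚ
  ... | yes _ = refl
  ... | no ≢1 = ⊥-elim (≢1 ≡1)

  notTight⇒<1 : ∀ φ → Feasible φ → ∀ j → tightAt φ j ≡ false → ⟪ φ , V j ⟫ < 1ℚ
  notTight⇒<1 φ feasible j ¬tight = ≤∧≢⇒< (feasible j) (λ ≡1 → true≢false (trans (sym (≡1⇒tightAt φ j ≡1)) ¬tight))

  SpannedBy : (Fin m → Bool) → Pt n → Set
  SpannedBy T v = Σ (Fin m → ℚ) λ e → (∀ j → T j ≡ false → e j ≡ 0ℚ) × (v ≋ lincomb e V)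

  SeparatedFrom : (Fin m → Bool) → Pt n → Set
  SeparatedFrom T v = Σ (Pt n) λ ψ → (∀ j → T j ≡ true → ⟪ ψ , V j ⟫ ≡ 0ℚ) × (⟪ ψ , v ⟫ < 0ℚ)

  -- Farkas' lemma applied to the generators ± V j, j ∈ T.
  spanned⊎separated : ∀ T v → SpannedBy T v ⊎ SeparatedFrom T v
  spanned⊎separated T v = Sum.map spanned separated (farkas (m ℕ.+ m) (V⁺ ++ V⁻) v)
    where
    V⁺ V⁻ : Fin m → Pt n
    V⁺ j i = indicator T j * V j i
    V⁻ j i = (- indicator T j) * V j i
    spanned : NonNegCombination (V⁺ ++ V⁻) v → SpannedBy T v
    spanned (c , _ , v≋) = e , e≡0 , λ i → trans (v≋ i) (trans (lincomb-++ c V⁺ V⁻ i) (lincomb-± i))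
      where
      α β e : Fin m → ℚ
      α j = c (j ↑ˡ m)
      β j = c (m ↑ʳ j)
      e j = indicator T j * (α j - β j)
      e≡0 : ∀ j → T j ≡ false → e j ≡ 0ℚ
      e≡0 j ¬Tj = trans (cong (_* (α j - β j)) (indicator-false T j ¬Tj)) (*-zeroˡ (α j - β j))
      lincomb-± : ∀ i → lincomb α V⁺ i + lincomb β V⁻ i ≡ lincomb e V i
      lincomb-± i = trans (sym (∑-distrib-+ (λ j → α j * V⁺ j i) (λ j → β j * V⁻ j i)))
                          (∑-cong (λ j → collect (α j) (β j) (indicator T j) (V j i)))
        where
        collect : ∀ a b t x → a * (t * x) + b * ((- t) * x) ≡ t * (a - b) * x
        collect = solve-∀ ringQ
    separated : Separator (V⁺ ++ V⁻) v → SeparatedFrom T v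
    separated (ψ , ψ≥0 , ψv<0) = ψ , vanish , ψv<0
      where
      ⟪ψ,V⁺⟫ : ∀ j → T j ≡ true → ⟪ ψ , (V⁺ ++ V⁻) (j ↑ˡ m) ⟫ ≡ ⟪ ψ , V j ⟫
      ⟪ψ,V⁺⟫ j Tj = trans (⟪⟫-congʳ ψ (λ i → cong (λ u → u i) (lookup-++ˡ V⁺ V⁻ j)))
                          (trans (⟪⟫-scaleʳ (indicator T j) ψ (V j))
                                 (trans (cong (_* ⟪ ψ , V j ⟫) (indicator-true T j Tj)) (*-identityˡ _)))
      ⟪ψ,V⁻⟫ : ∀ j → T j ≡ true → ⟪ ψ , (V⁺ ++ V⁻) (m ↑ʳ j) ⟫ ≡ - ⟪ ψ , V j ⟫
      ⟪ψ,V⁻⟫ j Tj = trans (⟪⟫-congʳ ψ (λ i → cong (λ u → u i) (lookup-++ʳ V⁺ V⁻ j)))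
                          (trans (⟪⟫-scaleʳ (- indicator T j) ψ (V j))
                                 (trans (cong (λ t → (- t) * ⟪ ψ , V j ⟫) (indicator-true T j Tj)) (-1*p≡-p _)))
        where
        -1*p≡-p : ∀ p → (- 1ℚ) * p ≡ - p
        -1*p≡-p = solve-∀ ringQ
      vanish : ∀ j → T j ≡ true → ⟪ ψ , V j ⟫ ≡ 0ℚ
      vanish j Tj = ≤-antisym (subst (_≤ 0ℚ) (neg-involutive _) (neg-antimono-≤ (subst (0ℚ ≤_) (⟪ψ,V⁻⟫ j Tj) (ψ≥0 (m ↑ʳ j)))))
                              (subst (0ℚ ≤_) (⟪ψ,V⁺⟫ j Tj) (ψ≥0 (j ↑ˡ m)))

  spanned⇒vertex : ∀ φ → Feasible φ → (∀ k → SpannedBy (tightAt φ) (V k)) → IsVertexDual V φ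
  spanned⇒vertex φ feasible spans = Feasible⇒InDual φ feasible , λ ψ₁ ψ₂ t ψ₁∈ ψ₂∈ t>0 t<1 φ≈ →
    agreeOnVertices⇒SameOnLin ψ₁ ψ₂ (agree ψ₁ ψ₂ t ψ₁∈ ψ₂∈ t>0 t<1 φ≈)
    where
    agree : ∀ (ψ₁ ψ₂ : Pt n) (t : ℚ) → InDual V ψ₁ → InDual V ψ₂ → 0ℚ < t → t < 1ℚ →
      SameOnLin V φ (λ i → t * ψ₁ i + (1ℚ - t) * ψ₂ i) → ∀ k → ⟪ ψ₁ , V k ⟫ ≡ ⟪ ψ₂ , V k ⟫
    agree ψ₁ ψ₂ t ψ₁∈ ψ₂∈ t>0 t<1 φ≈ k with spans k
    ... | e , e≡0 , Vk≋ = trans (⟪⟫-≋lincomb ψ₁ e V Vk≋) (trans (∑-cong term) (sym (⟪⟫-≋lincomb ψ₂ e V Vk≋)))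
      where
      bothTight : ∀ j → tightAt φ j ≡ true → ⟪ ψ₁ , V j ⟫ ≡ 1ℚ × ⟪ ψ₂ , V j ⟫ ≡ 1ℚ
      bothTight j tight = convex-≡1 t>0 t<1 (InDual⇒Feasible ψ₁ ψ₁∈ j) (InDual⇒Feasible ψ₂ ψ₂∈ j)
        (trans (sym (⟪⟫-linearˡ t (1ℚ - t) ψ₁ ψ₂ (V j))) (trans (sym (φ≈ (V j) (vertex∈lin j))) (tightAt⇒≡1 φ j tight)))
      term : ∀ j → e j * ⟪ ψ₁ , V j ⟫ ≡ e j * ⟪ ψ₂ , V j ⟫
      term j with tightAt φ j in tight
      ... | true = cong (e j *_) (trans (proj₁ (bothTight j tight)) (sym (proj₂ (bothTight j tight))))
      ... | false = trans (cong (_* ⟪ ψ₁ , V j ⟫) (e≡0 j tight))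
                          (trans (*-zeroˡ ⟪ ψ₁ , V j ⟫) (sym (trans (cong (_* ⟪ ψ₂ , V j ⟫) (e≡0 j tight)) (*-zeroˡ ⟪ ψ₂ , V j ⟫))))

  move : Pt n → ℚ → Pt n → Pt n
  move φ s ψ i = 1ℚ * φ i + s * ψ i

  ⟪move⟫ : ∀ φ s ψ v → ⟪ move φ s ψ , v ⟫ ≡ ⟪ φ , v ⟫ + s * ⟪ ψ , v ⟫
  ⟪move⟫ φ s ψ v = trans (⟪⟫-linearˡ 1ℚ s φ ψ v) (cong (_+ s * ⟪ ψ , v ⟫) (*-identityˡ ⟪ φ , v ⟫))

  move-feasible : ∀ φ s ψ → (∀ j → s * ⟪ ψ , V j ⟫ ≤ 1ℚ - ⟪ φ , V j ⟫) → Feasible (move φ s ψ)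
  move-feasible φ s ψ step≤slack j = subst₂ _≤_ (sym (trans (⟪move⟫ φ s ψ (V j)) (+-comm ⟪ φ , V j ⟫ _)))
    (p+[1-p]≡1 ⟪ φ , V j ⟫) (+-monoˡ-≤ ⟪ φ , V j ⟫ (step≤slack j))
    where
    p+[1-p]≡1 : ∀ p → 1ℚ - p + p ≡ 1ℚ
    p+[1-p]≡1 = solve-∀ ringQ

  smallStep : ∀ φ ψ → Feasible φ → (∀ j → tightAt φ j ≡ true → ⟪ ψ , V j ⟫ ≡ 0ℚ) →
    Σ ℚ λ ε → 0ℚ < ε × (∀ j → ε * ∣ ⟪ ψ , V j ⟫ ∣ ≤ 1ℚ - ⟪ φ , V j ⟫)
  smallStep φ ψ feasible vanish with positiveLowerBound (λ j → tightAt φ j ≡ false) (λ j → tightAt φ j Bool.≟ false) g g>0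
    where
    g : Fin m → ℚ
    g j = (1ℚ - ⟪ φ , V j ⟫) * recip (1ℚ + ∣ ⟪ ψ , V j ⟫ ∣)
    g>0 : ∀ j → tightAt φ j ≡ false → 0ℚ < g j
    g>0 j ¬tight = *-pos (p<q⇒0<q-p (notTight⇒<1 φ feasible j ¬tight)) (recip-pos (0<1+∣p∣ ⟪ ψ , V j ⟫))
  ... | ε , ε>0 , ε≤g = ε , ε>0 , bound
    where
    bound : ∀ j → ε * ∣ ⟪ ψ , V j ⟫ ∣ ≤ 1ℚ - ⟪ φ , V j ⟫
    bound j with tightAt φ j in tight
    ... | true rewrite vanish j tight | tightAt⇒≡1 φ j tight = ≤-reflexive (*-zeroʳ ε)
    ... | false = ≤-trans (*-monoˡ-≤-0≤ (<⇒≤ ε>0) ∣p∣≤1+∣p∣)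
                          (subst₂ _≤_ (*-comm (1ℚ + ∣ p ∣) ε) (*-recip-cancelˡ (1ℚ + ∣ p ∣) (1ℚ - ⟪ φ , V j ⟫) 1+∣p∣≢0)
                                 (*-monoˡ-≤-0≤ (<⇒≤ (0<1+∣p∣ p)) (ε≤g j tight)))
      where
      p = ⟪ ψ , V j ⟫
      1+∣p∣≢0 : 1ℚ + ∣ p ∣ ≢ 0ℚ
      1+∣p∣≢0 = 0<p⇒p≢0 (0<1+∣p∣ p)
      ∣p∣≤1+∣p∣ : ∣ p ∣ ≤ 1ℚ + ∣ p ∣
      ∣p∣≤1+∣p∣ = subst (_≤ 1ℚ + ∣ p ∣) (+-identityˡ ∣ p ∣) (+-monoˡ-≤ ∣ p ∣ 0≤1)

  -- φ is the midpoint of φ ± ε ψ, which are both in P^∨ and differ at V k.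
  vertex-not-separated : ∀ φ → IsVertexDual V φ → ∀ k → ¬ SeparatedFrom (tightAt φ) (V k)
  vertex-not-separated φ (φ∈P^∨ , extreme) k (ψ , vanish , ψk<0)
    with smallStep φ ψ (InDual⇒Feasible φ φ∈P^∨) vanish
  ... | ε , ε>0 , bound = <-irrefl refl (<-trans εψk<0 (subst (0ℚ <_) (sym εψk≡-εψk) -εψk>0))
    where
    ψk = ⟪ ψ , V k ⟫
    ±-feasible : ∀ s → (∀ p → s * p ≤ ε * ∣ p ∣) → InDual V (move φ s ψ)
    ±-feasible s s≤ε∣∣ = Feasible⇒InDual (move φ s ψ) (move-feasible φ s ψ (λ j → ≤-trans (s≤ε∣∣ _) (bound j)))
    +ε≤ : ∀ p → ε * p ≤ ε * ∣ p ∣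
    +ε≤ p = *-monoˡ-≤-0≤ (<⇒≤ ε>0) (p≤∣p∣ p)
    -ε≤ : ∀ p → (- ε) * p ≤ ε * ∣ p ∣
    -ε≤ p = subst (_≤ ε * ∣ p ∣) (trans (sym (neg-distribʳ-* ε p)) (neg-distribˡ-* ε p))
                  (*-monoˡ-≤-0≤ (<⇒≤ ε>0) (-p≤∣p∣ p))
    ½>0 : 0ℚ < ½
    ½>0 = toWitness {a? = 0ℚ <? ½} _
    ½<1 : ½ < 1ℚ
    ½<1 = toWitness {a? = ½ <? 1ℚ} _
    midpoint : SameOnLin V φ (λ i → ½ * move φ ε ψ i + (1ℚ - ½) * move φ (- ε) ψ i)
    midpoint a _ = ⟪⟫-congˡ a (λ i → sym (trans (average ½ (φ i) ε (ψ i))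
                                         (trans (cong (λ z → φ i + z * ε * ψ i) ½+½-1≡0) (drop (φ i) ε (ψ i)))))
      where
      ½+½-1≡0 : ½ + ½ - 1ℚ ≡ 0ℚ
      ½+½-1≡0 = refl
      average : ∀ h a e b → h * (1ℚ * a + e * b) + (1ℚ - h) * (1ℚ * a + (- e) * b) ≡ a + (h + h - 1ℚ) * e * b
      average = solve-∀ ringQ
      drop : ∀ a e b → a + 0ℚ * e * b ≡ a
      drop = solve-∀ ringQ
    εψk≡-εψk : ε * ψk ≡ (- ε) * ψk
    εψk≡-εψk = +-cancelˡ-≡ ⟪ φ , V k ⟫ (trans (sym (⟪move⟫ φ ε ψ (V k))) (trans
      (extreme (move φ ε ψ) (move φ (- ε) ψ) ½ (±-feasible ε +ε≤) (±-feasible (- ε) -ε≤) ½>0 ½<1 midpoint (V k) (vertex∈lin k))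
      (⟪move⟫ φ (- ε) ψ (V k))))
    εψk<0 : ε * ψk < 0ℚ
    εψk<0 = subst (_< 0ℚ) (trans (neg-distribʳ-* ε (- ψk)) (cong (ε *_) (neg-involutive ψk)))
                  (neg-antimono-< (*-pos ε>0 (neg-antimono-< ψk<0)))
    -εψk>0 : 0ℚ < (- ε) * ψk
    -εψk>0 = subst (0ℚ <_) (trans (sym (neg-distribʳ-* ε ψk)) (neg-distribˡ-* ε ψk))
                   (*-pos ε>0 (neg-antimono-< ψk<0))

  vertex⇒spanned : ∀ φ → IsVertexDual V φ → ∀ k → SpannedBy (tightAt φ) (V k)
  vertex⇒spanned φ vertex k =
    Sum.[ (λ spanned → spanned) , (λ separated → ⊥-elim (vertex-not-separated φ vertex k separated)) ]′
      (spanned⊎separated (tightAt φ) (V k))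

  -- Ratio test: the longest step from φ along - ψ that stays in P^∨ makes some V j₀ tight.
  moveToNextFacet : ∀ φ k → Feasible φ → SeparatedFrom (tightAt φ) (V k) →
    Σ (Pt n) λ φ′ → Feasible φ′ × tightAt φ ⊆ᵇ tightAt φ′ ×
      Σ (Fin m) λ j₀ → tightAt φ j₀ ≡ false × tightAt φ′ j₀ ≡ true
  moveToNextFacet φ k feasible (ψ , vanish , ψk<0)
    with argmin (λ j → ⟪ ψ , V j ⟫ < 0ℚ) (λ j → ⟪ ψ , V j ⟫ <? 0ℚ) (λ j → (1ℚ - ⟪ φ , V j ⟫) * recip (- ⟪ ψ , V j ⟫))
  ... | inj₁ none = ⊥-elim (none k ψk<0)
  ... | inj₂ (j₀ , ψj₀<0 , min) = move φ (- ε) ψ , move-feasible φ (- ε) ψ step≤slack , stillTight , j₀ , j₀-slack , j₀-tight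
    where
    ratio : Fin m → ℚ
    ratio j = (1ℚ - ⟪ φ , V j ⟫) * recip (- ⟪ ψ , V j ⟫)
    ε = ratio j₀
    -ε*p≡-p*ε : ∀ p → (- ε) * p ≡ (- p) * ε
    -ε*p≡-p*ε = swap-neg ε
      where
      swap-neg : ∀ e p → (- e) * p ≡ (- p) * e
      swap-neg = solve-∀ ringQ
    step≤slack : ∀ j → (- ε) * ⟪ ψ , V j ⟫ ≤ 1ℚ - ⟪ φ , V j ⟫
    step≤slack j with ⟪ ψ , V j ⟫ <? 0ℚ
    ... | yes ψj<0 = subst₂ _≤_ (sym (-ε*p≡-p*ε ⟪ ψ , V j ⟫)) (*-recip-cancelˡ (- ⟪ ψ , V j ⟫) (1ℚ - ⟪ φ , V j ⟫) (0<p⇒p≢0 (neg-antimono-< ψj<0)))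
                            (*-monoˡ-≤-0≤ (<⇒≤ (neg-antimono-< ψj<0)) (min j ψj<0))
    ... | no ψj≮0 = ≤-trans (subst (_≤ 0ℚ) (sym (-ε*p≡-p*ε ⟪ ψ , V j ⟫)) (*-nonPos-nonNeg (neg-antimono-≤ (≮⇒≥ ψj≮0)) ε≥0))
                            (p≤q⇒0≤q-p (feasible j))
      where
      ε≥0 : 0ℚ ≤ ε
      ε≥0 = *-nonNeg (p≤q⇒0≤q-p (feasible j₀)) (<⇒≤ (recip-pos (neg-antimono-< ψj₀<0)))
      *-nonPos-nonNeg : ∀ {p q} → p ≤ 0ℚ → 0ℚ ≤ q → p * q ≤ 0ℚ
      *-nonPos-nonNeg {p} {q} p≤0 q≥0 = nonPositive⁻¹ _ {{nonPos*nonNeg⇒nonPos p {{nonPositive p≤0}} q {{nonNegative q≥0}}}}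
    stillTight : tightAt φ ⊆ᵇ tightAt (move φ (- ε) ψ)
    stillTight j tight = ≡1⇒tightAt (move φ (- ε) ψ) j (trans (⟪move⟫ φ (- ε) ψ (V j))
      (trans (cong₂ (λ a b → a + (- ε) * b) (tightAt⇒≡1 φ j tight) (vanish j tight)) (1+x*0≡1 (- ε))))
      where
      1+x*0≡1 : ∀ x → 1ℚ + x * 0ℚ ≡ 1ℚ
      1+x*0≡1 = solve-∀ ringQ
    j₀-tight : tightAt (move φ (- ε) ψ) j₀ ≡ true
    j₀-tight = ≡1⇒tightAt (move φ (- ε) ψ) j₀ (trans (⟪move⟫ φ (- ε) ψ (V j₀)) (trans (cong (⟪ φ , V j₀ ⟫ +_) (-ε*p≡-p*ε ⟪ ψ , V j₀ ⟫))
      (trans (cong (⟪ φ , V j₀ ⟫ +_) (*-recip-cancelˡ (- ⟪ ψ , V j₀ ⟫) (1ℚ - ⟪ φ , V j₀ ⟫) (0<p⇒p≢0 (neg-antimono-< ψj₀<0))))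
             (p+[1-p]≡1 ⟪ φ , V j₀ ⟫))))
      where
      p+[1-p]≡1 : ∀ p → p + (1ℚ - p) ≡ 1ℚ
      p+[1-p]≡1 = solve-∀ ringQ
    j₀-slack : tightAt φ j₀ ≡ false
    j₀-slack with tightAt φ j₀ in tight
    ... | true = ⊥-elim (<-irrefl (vanish j₀ tight) ψj₀<0)
    ... | false = refl

  supported⇒slack : ∀ φ ν → (∀ j → tightAt φ j ≡ false → ν j ≡ 0ℚ) → ComplementarySlack φ ν
  supported⇒slack φ ν supported j with tightAt φ j in tight
  ... | true = trans (cong (ν j *_) (tightAt⇒≡1 φ j tight)) (*-identityʳ (ν j))
  ... | false = trans (cong (_* ⟪ φ , V j ⟫) (supported j tight)) (trans (*-zeroˡ ⟪ φ , V j ⟫) (sym (supported j tight)))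

  positive⇒slack : ∀ φ ν → (∀ j → 0ℚ ≤ ν j) → (∀ j → 0ℚ < ν j → tightAt φ j ≡ true) → ComplementarySlack φ ν
  positive⇒slack φ ν ν≥0 tight j with <-cmp 0ℚ (ν j)
  ... | tri< νj>0 _ _ = trans (cong (ν j *_) (tightAt⇒≡1 φ j (tight j νj>0))) (*-identityʳ (ν j))
  ... | tri≈ _ 0≡νj _ = trans (cong (_* ⟪ φ , V j ⟫) (sym 0≡νj)) (trans (*-zeroˡ ⟪ φ , V j ⟫) 0≡νj)
  ... | tri> _ _ νj<0 = ⊥-elim (<-irrefl refl (<-≤-trans νj<0 (ν≥0 j)))

  spanned-lincomb : ∀ {T x} (e : Fin m → ℚ) → (∀ k → SpannedBy T (V k)) → x ≋ lincomb e V → SpannedBy T x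
  spanned-lincomb {T} e spans x≋ = e′ , e′≡0 ,
    ≋-trans x≋ (≋-trans (lincomb-congʳ e (λ k → proj₂ (proj₂ (spans k)))) (lincomb-lincomb e E V))
    where
    E : Fin m → Fin m → ℚ
    E k = proj₁ (spans k)
    e′ : Fin m → ℚ
    e′ j = ∑ (λ k → e k * E k j)
    e′≡0 : ∀ j → T j ≡ false → e′ j ≡ 0ℚ
    e′≡0 j ¬Tj = trans (∑-cong (λ k → trans (cong (e k *_) (proj₁ (proj₂ (spans k)) j ¬Tj)) (*-zeroʳ (e k)))) (∑-zero {m})

  vertex-above : ∀ φ → Feasible φ → Σ (Pt n) λ φ′ → IsVertexDual V φ′ × tightAt φ ⊆ᵇ tightAt φ′
  vertex-above φ feasible = go φ feasible (<-wellFounded (countFalse (tightAt φ)))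
    where
    Above : Pt n → Set
    Above φ = Σ (Pt n) λ φ′ → IsVertexDual V φ′ × tightAt φ ⊆ᵇ tightAt φ′
    go : ∀ φ → Feasible φ → Acc ℕ._<_ (countFalse (tightAt φ)) → Above φ
    go φ feasible (acc smaller) =
      Sum.[ (λ spans → φ , spanned⇒vertex φ feasible spans , λ _ tight → tight)
          , (λ (k , separated) → climb (moveToNextFacet φ k feasible separated)) ]′
        (all⊎any (λ k → spanned⊎separated (tightAt φ) (V k)))
      where
      climb : (Σ (Pt n) λ φ′ → Feasible φ′ × tightAt φ ⊆ᵇ tightAt φ′ ×
                Σ (Fin m) λ j₀ → tightAt φ j₀ ≡ false × tightAt φ′ j₀ ≡ true) → Above φ
      climb (φ′ , feasible′ , φ⊆φ′ , j₀ , j₀-slack , j₀-tight)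
        with go φ′ feasible′ (smaller (countFalse-< φ⊆φ′ j₀ j₀-slack j₀-tight))
      ... | φ″ , vertex , φ′⊆φ″ = φ″ , vertex , λ j tight → φ′⊆φ″ j (φ⊆φ′ j tight)

-- Linear programming duality for the height of a point of cone P

module MinimalHeight {n m : ℕ} (V : Fin m → Pt n) (x : Pt n) (μ : Fin m → ℚ)
  (μ≥0 : ∀ j → 0ℚ ≤ μ j) (x≋ : x ≋ lincomb μ V) where
  open Polytope V

  -- Generators (1 , V j) and - μ j (1 , V j) of ℚ^{1+n}, and the target (- 1 , 0): a nonnegative
  -- combination reaching the target shortens μ, while a separator is (up to scaling) the dual φ.
  A⁺ A⁻ : Fin m → Pt (suc n)
  A⁺ j = 1ℚ ∷ V j
  A⁻ j = (- μ j) ∷ (λ i → (- μ j) * V j i)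

  b : Pt (suc n)
  b = (- 1ℚ) ∷ zeroPt

  cone⇒shorter : NonNegCombination (A⁺ ++ A⁻) b →
    Σ (Fin m → ℚ) λ μ′ → (∀ j → 0ℚ ≤ μ′ j) × (x ≋ lincomb μ′ V) × (∑ μ′ < ∑ μ)
  cone⇒shorter (c , c≥0 , b≋) = μ′ , μ′≥0 , x≋′ , ∑μ′<∑μ
    where
    α β ν : Fin m → ℚ
    α j = c (j ↑ˡ m)
    β j = c (m ↑ʳ j)
    ν j = α j * 1ℚ + β j * (- μ j)
    b≋′ : ∀ i → b i ≡ lincomb α A⁺ i + lincomb β A⁻ i
    b≋′ i = trans (b≋ i) (lincomb-++ c A⁺ A⁻ i)
    ∑ν≡-1 : ∑ ν ≡ - 1ℚ
    ∑ν≡-1 = sym (trans (b≋′ zero) (sym (∑-distrib-+ (λ j → α j * 1ℚ) (λ j → β j * (- μ j)))))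
    νV≡0 : ∀ i → lincomb ν V i ≡ 0ℚ
    νV≡0 i = sym (trans (b≋′ (suc i)) (trans (sym (∑-distrib-+ (λ j → α j * V j i) (λ j → β j * ((- μ j) * V j i)))) (∑-cong (λ j → collect (α j) (β j) (μ j) (V j i)))))
      where
      collect : ∀ a b u v → a * v + b * ((- u) * v) ≡ (a * 1ℚ + b * (- u)) * v
      collect = solve-∀ ringQ
    B = 1ℚ + ∑ β
    B>0 : 0ℚ < B
    B>0 = +-mono-<-≤ 0<1 (∑-nonNeg (λ j → c≥0 (m ↑ʳ j)))
    ε = recip B
    ε>0 : 0ℚ < ε
    ε>0 = recip-pos B>0
    μ′ : Fin m → ℚ
    μ′ j = 1ℚ * μ j + ε * ν j
    μ′≥0 : ∀ j → 0ℚ ≤ μ′ j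
    μ′≥0 j = subst (0ℚ ≤_) (regroup (μ j) ε (α j) (β j))
      (+-mono-≤ (*-nonNeg (μ≥0 j) (p≤q⇒0≤q-p εβ≤1)) (*-nonNeg (<⇒≤ ε>0) (c≥0 (j ↑ˡ m))))
      where
      regroup : ∀ u e a b → u * (1ℚ - e * b) + e * a ≡ 1ℚ * u + e * (a * 1ℚ + b * (- u))
      regroup = solve-∀ ringQ
      β≤B : β j ≤ B
      β≤B = ≤-trans (term≤∑ (λ j → c≥0 (m ↑ʳ j)) j) (subst (_≤ B) (+-identityˡ (∑ β)) (+-monoˡ-≤ (∑ β) 0≤1))
      εβ≤1 : ε * β j ≤ 1ℚ
      εβ≤1 = subst (ε * β j ≤_) (trans (*-comm ε B) (*-recipʳ B (0<p⇒p≢0 B>0))) (*-monoˡ-≤-0≤ (<⇒≤ ε>0) β≤B)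
    x≋′ : x ≋ lincomb μ′ V
    x≋′ i = trans (x≋ i) (trans (pad (lincomb μ V i) ε)
              (trans (cong (λ z → 1ℚ * lincomb μ V i + ε * z) (sym (νV≡0 i))) (lincomb-linear 1ℚ ε μ ν V i)))
      where
      pad : ∀ a e → a ≡ 1ℚ * a + e * 0ℚ
      pad = solve-∀ ringQ
    ∑μ′<∑μ : ∑ μ′ < ∑ μ
    ∑μ′<∑μ = subst (_< ∑ μ) (sym (trans (∑-linear 1ℚ ε μ ν) (trans (cong (λ z → 1ℚ * ∑ μ + ε * z) ∑ν≡-1) (subtract (∑ μ) ε))))
               (0<q-p⇒p<q (subst (0ℚ <_) (unshift (∑ μ) ε) ε>0))
      where
      subtract : ∀ s e → 1ℚ * s + e * (- 1ℚ) ≡ s - e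
      subtract = solve-∀ ringQ
      unshift : ∀ s e → e ≡ s - (s - e)
      unshift = solve-∀ ringQ

  separator⇒tightDual : Separator (A⁺ ++ A⁻) b →
    Σ (Pt n) λ φ → Feasible φ × (∀ j → 0ℚ < μ j → ⟪ φ , V j ⟫ ≡ 1ℚ)
  separator⇒tightDual (y , y≥0 , yb<0) = φ , feasible , tight
    where
    σ = y zero
    ψ : Pt n
    ψ i = y (suc i)
    ⟪y,A⁺⟫ : ∀ j → ⟪ y , (A⁺ ++ A⁻) (j ↑ˡ m) ⟫ ≡ σ * 1ℚ + ⟪ ψ , V j ⟫
    ⟪y,A⁺⟫ j = ⟪⟫-congʳ y (λ i → cong (λ u → u i) (lookup-++ˡ A⁺ A⁻ j))
    ⟪y,A⁻⟫ : ∀ j → ⟪ y , (A⁺ ++ A⁻) (m ↑ʳ j) ⟫ ≡ σ * (- μ j) + ⟪ ψ , (λ i → (- μ j) * V j i) ⟫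
    ⟪y,A⁻⟫ j = ⟪⟫-congʳ y (λ i → cong (λ u → u i) (lookup-++ʳ A⁺ A⁻ j))
    σ>0 : 0ℚ < σ
    σ>0 = subst (0ℚ <_) (neg-neg σ) (neg-antimono-< (subst (_< 0ℚ) (cong (σ * (- 1ℚ) +_) ⟪ψ,0⟫≡0) yb<0))
      where
      ⟪ψ,0⟫≡0 : ⟪ ψ , zeroPt ⟫ ≡ 0ℚ
      ⟪ψ,0⟫≡0 = trans (∑-cong (λ i → *-zeroʳ (ψ i))) (∑-zero {n})
      neg-neg : ∀ s → - (s * (- 1ℚ) + 0ℚ) ≡ s
      neg-neg = solve-∀ ringQ
    slack : Fin m → ℚ
    slack j = σ + ⟪ ψ , V j ⟫
    slack≥0 : ∀ j → 0ℚ ≤ slack j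
    slack≥0 j = subst (0ℚ ≤_) (trans (⟪y,A⁺⟫ j) (cong (_+ ⟪ ψ , V j ⟫) (*-identityʳ σ))) (y≥0 (j ↑ˡ m))
    -μ*slack≥0 : ∀ j → 0ℚ ≤ - μ j * slack j
    -μ*slack≥0 j = subst (0ℚ ≤_) (trans (⟪y,A⁻⟫ j) (trans (cong (σ * (- μ j) +_) (⟪⟫-scaleʳ (- μ j) ψ (V j)))
                                                           (factor σ (μ j) ⟪ ψ , V j ⟫)))
                         (y≥0 (m ↑ʳ j))
      where
      factor : ∀ s u p → s * (- u) + (- u) * p ≡ - u * (s + p)
      factor = solve-∀ ringQ
    φ : Pt n
    φ i = (- recip σ) * ψ i
    ⟪φ,V⟫ : ∀ j → ⟪ φ , V j ⟫ ≡ 1ℚ - recip σ * slack j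
    ⟪φ,V⟫ j = trans (⟪⟫-scaleˡ (- recip σ) ψ (V j)) (trans (expand σ (recip σ) ⟪ ψ , V j ⟫)
                    (cong (λ z → z - recip σ * slack j) (*-recipʳ σ (0<p⇒p≢0 σ>0))))
      where
      expand : ∀ s r p → (- r) * p ≡ s * r - r * (s + p)
      expand = solve-∀ ringQ
    feasible : Feasible φ
    feasible j = subst (_≤ 1ℚ) (sym (⟪φ,V⟫ j))
      (0≤q-p⇒p≤q (subst (0ℚ ≤_) (q≡1-[1-q] (recip σ * slack j)) (*-nonNeg (<⇒≤ (recip-pos σ>0)) (slack≥0 j))))
      where
      q≡1-[1-q] : ∀ q → q ≡ 1ℚ - (1ℚ - q)
      q≡1-[1-q] = solve-∀ ringQ
    tight : ∀ j → 0ℚ < μ j → ⟪ φ , V j ⟫ ≡ 1ℚ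
    tight j μj>0 = trans (⟪φ,V⟫ j) (trans (cong (λ z → 1ℚ - recip σ * z) slack≡0) (1-r*0≡1 (recip σ)))
      where
      1-r*0≡1 : ∀ r → 1ℚ - r * 0ℚ ≡ 1ℚ
      1-r*0≡1 = solve-∀ ringQ
      μ*slack≡0 : μ j * slack j ≡ 0ℚ
      μ*slack≡0 = ≤-antisym (subst (_≤ 0ℚ) (neg-neg (μ j) (slack j)) (neg-antimono-≤ (-μ*slack≥0 j)))
                            (*-nonNeg (<⇒≤ μj>0) (slack≥0 j))
        where
        neg-neg : ∀ u g → - (- u * g) ≡ u * g
        neg-neg = solve-∀ ringQ
      slack≡0 : slack j ≡ 0ℚ
      slack≡0 = *-cancel-≡0 (μ j) (0<p⇒p≢0 μj>0) μ*slack≡0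

  minimal⇒tightDual : (∀ μ′ → (∀ j → 0ℚ ≤ μ′ j) → x ≋ lincomb μ′ V → ∑ μ ≤ ∑ μ′) →
    Σ (Pt n) λ φ → Feasible φ × (∀ j → 0ℚ < μ j → ⟪ φ , V j ⟫ ≡ 1ℚ)
  minimal⇒tightDual minimal = dual (farkas (m ℕ.+ m) (A⁺ ++ A⁻) b)
    where
    dual : NonNegCombination (A⁺ ++ A⁻) b ⊎ Separator (A⁺ ++ A⁻) b →
      Σ (Pt n) λ φ → Feasible φ × (∀ j → 0ℚ < μ j → ⟪ φ , V j ⟫ ≡ 1ℚ)
    dual (inj₁ cone) = let μ′ , μ′≥0 , x≋′ , ∑μ′<∑μ = cone⇒shorter cone in
      ⊥-elim (<-irrefl refl (<-≤-trans ∑μ′<∑μ (minimal μ′ μ′≥0 x≋′)))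
    dual (inj₂ separator) = separator⇒tightDual separator

module Envelopes {n m : ℕ} (V : Fin m → Pt n) where
  open Polytope V
  open Vertices V

  Lowest : Pt n → ℚ → Set
  Lowest x k = InCone V (x , k) × (∀ k′ → InCone V (x , k′) → k ≤ k′)

  IsEps⇒Lowest : ∀ p {y k} → IsEps (InCone V) p (y , k) → Lowest y k
  IsEps⇒Lowest (x , h) {y} {k} (λ′ , lowered∈C , maximal , y≋x , k≡h-λ′) =
    InCone-cong (≋-sym y≋x) (sym k≡h-λ′) lowered∈C , lowest
    where
    lowest : ∀ k′ → InCone V (y , k′) → k ≤ k′
    lowest k′ y,k′∈C = subst (_≤ k′) (sym k≡h-λ′) (0≤q-p⇒p≤q (subst (0ℚ ≤_) (swap h k′ λ′) (p≤q⇒0≤q-p h-k′≤λ′)))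
      where
      k′≡h-[h-k′] : ∀ h k′ → k′ ≡ h - (h - k′)
      k′≡h-[h-k′] = solve-∀ ringQ
      swap : ∀ h k′ λ′ → λ′ - (h - k′) ≡ k′ - (h - λ′)
      swap = solve-∀ ringQ
      h-k′≤λ′ : h - k′ ≤ λ′
      h-k′≤λ′ = maximal (h - k′) (InCone-cong y≋x (k′≡h-[h-k′] h k′) y,k′∈C)

  Lowest⇒IsEps : ∀ {x k} h → Lowest x k → IsEps (InCone V) (x , h) (x , k)
  Lowest⇒IsEps {x} {k} h (x,k∈C , lowest) =
    h - k , InCone-cong (λ _ → refl) (k≡h-[h-k] h k) x,k∈C , maximal , (λ _ → refl) , k≡h-[h-k] h k
    where
    k≡h-[h-k] : ∀ h k → k ≡ h - (h - k)
    k≡h-[h-k] = solve-∀ ringQ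
    swap : ∀ h k μ → h - μ - k ≡ h - k - μ
    swap = solve-∀ ringQ
    maximal : ∀ μ → InCone V (x , h - μ) → μ ≤ h - k
    maximal μ x,h-μ∈C = 0≤q-p⇒p≤q (subst (0ℚ ≤_) (swap h k μ) (p≤q⇒0≤q-p (lowest (h - μ) x,h-μ∈C)))

  LowestHeightsIntegral : Set
  LowestHeightsIntegral = ∀ x k → IsIntPt x → Lowest x k → IsInt k

  lowestHeightsIntegral⇒llenv≡lenv∩ℤ : LowestHeightsIntegral → ∀ q → InLlenv (InCone V) q ⇔ (InLenv (InCone V) q × IsIntPt⁺ q)
  lowestHeightsIntegral⇒llenv≡lenv∩ℤ H (y , k) = mk⇔ llenv⇒lenv∩ℤ lenv∩ℤ⇒llenv
    where
    llenv⇒lenv∩ℤ : InLlenv (InCone V) (y , k) → InLenv (InCone V) (y , k) × IsIntPt⁺ (y , k)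
    llenv⇒lenv∩ℤ ((x , h) , p∈C , (x∈ℤ , _) , eps@(_ , _ , _ , y≋x , _)) =
      ((x , h) , p∈C , eps) , y∈ℤ , H y k y∈ℤ (IsEps⇒Lowest (x , h) eps)
      where
      y∈ℤ : IsIntPt y
      y∈ℤ i = subst IsInt (sym (y≋x i)) (x∈ℤ i)
    lenv∩ℤ⇒llenv : InLenv (InCone V) (y , k) × IsIntPt⁺ (y , k) → InLlenv (InCone V) (y , k)
    lenv∩ℤ⇒llenv ((p , _ , eps) , q∈ℤ) = let lowest = IsEps⇒Lowest p eps in
      (y , k) , proj₁ lowest , q∈ℤ , Lowest⇒IsEps k lowest

  module _ (0∈P : InP V zeroPt) where

    llenv⊆ℤ⇒lowestHeightsIntegral : (∀ q → InLlenv (InCone V) q → IsIntPt⁺ q) → LowestHeightsIntegral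
    llenv⊆ℤ⇒lowestHeightsIntegral llenv⊆ℤ x k x∈ℤ lowest =
      let N , k≤N = archimedean k in
      proj₂ (llenv⊆ℤ (x , k) ((x , ℤ.+ N / 1) , InCone-raise 0∈P (proj₁ lowest) k≤N , (x∈ℤ , IsInt-/1 (ℤ.+ N)) ,
                               Lowest⇒IsEps (ℤ.+ N / 1) lowest))

    lattice⇒lowestHeightsIntegral : IsLatticePolyhedronDual V → LowestHeightsIntegral
    lattice⇒lowestHeightsIntegral lattice x k x∈ℤ (x,k∈C , lowest) =
      let μ , μ≥0 , x≋ , ∑μ≡k = InCone⇒lincomb x,k∈C
          minimal = λ μ′ μ′≥0 x≋′ → subst (_≤ ∑ μ′) (sym ∑μ≡k) (lowest (∑ μ′) (lincomb⇒InCone 0∈P μ′ μ′≥0 x≋′))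
          φ₀ , φ₀-feasible , φ₀-tight = MinimalHeight.minimal⇒tightDual V x μ μ≥0 x≋ minimal
          φ , vertex , φ₀⊆φ = vertex-above φ₀ φ₀-feasible
          slack = positive⇒slack φ μ μ≥0 (λ j μj>0 → φ₀⊆φ j (≡1⇒tightAt φ₀ j (φ₀-tight j μj>0)))
      in subst IsInt (trans (slack⇒⟪⟫≡∑ φ μ slack x≋) ∑μ≡k) (lattice φ vertex x (InCone⇒LinP x,k∈C) x∈ℤ)

    slack⇒IsInt : LowestHeightsIntegral → ∀ φ ν {z} → Feasible φ → IsIntPt z → (∀ j → 0ℚ ≤ ν j) → z ≋ lincomb ν V →
      ComplementarySlack φ ν → IsInt ⟪ φ , z ⟫
    slack⇒IsInt H φ ν {z} feasible z∈ℤ ν≥0 z≋ slack =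
      subst IsInt (sym ⟪φ,z⟫≡∑ν) (H z (∑ ν) z∈ℤ (lincomb⇒InCone 0∈P ν ν≥0 z≋ , lowest))
      where
      ⟪φ,z⟫≡∑ν : ⟪ φ , z ⟫ ≡ ∑ ν
      ⟪φ,z⟫≡∑ν = slack⇒⟪⟫≡∑ φ ν slack z≋
      lowest : ∀ k′ → InCone V (z , k′) → ∑ ν ≤ k′
      lowest k′ z,k′∈C = subst (_≤ k′) ⟪φ,z⟫≡∑ν (Feasible⇒≤height φ feasible z,k′∈C)

    -- a = x − N y, where x and y are integral points of cone P with coefficients supported on the tight set of φ.
    tightSpan-IsInt : LowestHeightsIntegral → ∀ φ → Feasible φ → ∀ {a} → IsIntPt a → (e : Fin m → ℚ) →
      (∀ j → tightAt φ j ≡ false → e j ≡ 0ℚ) → a ≋ lincomb e V → IsInt ⟪ φ , a ⟫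
    tightSpan-IsInt H φ feasible {a} a∈ℤ e e≡0 a≋ =
      let D , D>0 , _ , DV∈ℤ = commonDenominator² V
          N , N∈ℤ , ν≥0 = supported-shift-nonNeg T e e≡0 D>0
      in a≡x-Ny D (<⇒≤ D>0) DV∈ℤ N N∈ℤ ν≥0
      where
      T = tightAt φ
      a≡x-Ny : ∀ D → 0ℚ ≤ D → (∀ j i → IsInt (D * V j i)) → ∀ N → IsInt N →
        (∀ j → 0ℚ ≤ 1ℚ * e j + N * (indicator T j * D)) → IsInt ⟪ φ , a ⟫
      a≡x-Ny D D≥0 DV∈ℤ N N∈ℤ ν≥0 = subst IsInt (sym ⟪φ,a⟫≡) (IsInt-- ⟪φ,x⟫∈ℤ (IsInt-* N∈ℤ ⟪φ,y⟫∈ℤ))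
        where
        yc ν : Fin m → ℚ
        yc j = indicator T j * D
        ν j = 1ℚ * e j + N * yc j
        y x : Pt n
        y = lincomb yc V
        x i = 1ℚ * a i + N * y i
        y∈ℤ : IsIntPt y
        y∈ℤ i = IsInt-∑ (λ j → subst IsInt (sym (*-assoc (indicator T j) D (V j i))) (IsInt-* (indicator-IsInt T j) (DV∈ℤ j i)))
        x∈ℤ : IsIntPt x
        x∈ℤ i = IsInt-+ (IsInt-* IsInt-1 (a∈ℤ i)) (IsInt-* N∈ℤ (y∈ℤ i))
        x≋ : x ≋ lincomb ν V
        x≋ i = trans (cong (λ z → 1ℚ * z + N * y i) (a≋ i)) (lincomb-linear 1ℚ N e yc V i)
        yc≥0 : ∀ j → 0ℚ ≤ yc j
        yc≥0 j = *-nonNeg (indicator-nonNeg T j) D≥0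
        yc≡0 : ∀ j → T j ≡ false → yc j ≡ 0ℚ
        yc≡0 j ¬Tj = trans (cong (_* D) (indicator-false T j ¬Tj)) (*-zeroˡ D)
        ν≡0 : ∀ j → T j ≡ false → ν j ≡ 0ℚ
        ν≡0 j ¬Tj = trans (cong₂ (λ u v → 1ℚ * u + N * v) (e≡0 j ¬Tj) (yc≡0 j ¬Tj)) (vanish N)
          where
          vanish : ∀ N → 1ℚ * 0ℚ + N * 0ℚ ≡ 0ℚ
          vanish = solve-∀ ringQ
        ⟪φ,x⟫∈ℤ : IsInt ⟪ φ , x ⟫
        ⟪φ,x⟫∈ℤ = slack⇒IsInt H φ ν feasible x∈ℤ ν≥0 x≋ (supported⇒slack φ ν ν≡0)
        ⟪φ,y⟫∈ℤ : IsInt ⟪ φ , y ⟫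
        ⟪φ,y⟫∈ℤ = slack⇒IsInt H φ yc feasible y∈ℤ yc≥0 (λ _ → refl) (supported⇒slack φ yc yc≡0)
        ⟪φ,a⟫≡ : ⟪ φ , a ⟫ ≡ ⟪ φ , x ⟫ - N * ⟪ φ , y ⟫
        ⟪φ,a⟫≡ = trans (unshift ⟪ φ , a ⟫ (N * ⟪ φ , y ⟫)) (cong (_- N * ⟪ φ , y ⟫) (sym (⟪⟫-linearʳ 1ℚ N φ a y)))
          where
          unshift : ∀ p q → p ≡ 1ℚ * p + q - q
          unshift = solve-∀ ringQ

    lowestHeightsIntegral⇒lattice : LowestHeightsIntegral → IsLatticePolyhedronDual V
    lowestHeightsIntegral⇒lattice H φ vertex a a∈lin a∈ℤ =
      let e₀ , a≋₀ = LinP⇒lincomb a∈lin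
          e , e≡0 , a≋ = spanned-lincomb e₀ (vertex⇒spanned φ vertex) a≋₀
      in tightSpan-IsInt H φ (InDual⇒Feasible φ (proj₁ vertex)) a∈ℤ e e≡0 a≋

proposition3p2 : ∀ {n m : ℕ} (V : Fin m → Pt n) → InP V zeroPt →
    (IsLatticePolyhedronDual V ⇔
    (∀ (q : Pt⁺ n) → InLlenv (InCone V) q ⇔ (InLenv (InCone V) q × IsIntPt⁺ q)))
proposition3p2 V 0∈P = mk⇔
  (λ lattice → lowestHeightsIntegral⇒llenv≡lenv∩ℤ (lattice⇒lowestHeightsIntegral 0∈P lattice))
  (λ llenv≡lenv∩ℤ → lowestHeightsIntegral⇒lattice 0∈P
     (llenv⊆ℤ⇒lowestHeightsIntegral 0∈P (λ q q∈llenv → proj₂ (Equivalence.to (llenv≡lenv∩ℤ q) q∈llenv))))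
  where open Envelopes V
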